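{- Let $G$ be a nilpotent finite group, $N$ a cyclic normal subgroup of $G$ containing $G'$, and $S=\{\sigma_1,\dots,\sigma_\ell\}\subseteq G$ such that $\overline S$ is a minimal generating set of $\overline G=G/N$ and $\ell=\#S=\#\overline S\ge2$. Let $2\le k<\ell$, and write $m=m_{k+1}$ and $a=\sigma_{k+1}$. Suppose $\pi_1,\dots,\pi_m\in\mathcal V_k$; suppose $s_1,\dots,s_{m-1}\in S_k$ and for each $i$ a choice $s_i^*\in\{s_i,s_i^{ -1}\}$ has been made so that $s_{i+1}^*=s_i^*$ whenever $s_{i+1}=s_i$; and suppose $N\subseteq Z(G)$. Then there is a hamiltonian cycle in $\mathrm{Cay}(\overline{G_{k+1}};\overline{S_{k+1}})$ that covers $S_{k+1}^{\pm1}$ and whose voltage is $\left(\prod_{i=1}^m\pi_i\right)\left(\prod_{i=1}^{m-1}[a,s_i^*]\right)$.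
   Context: Notation: $g\mapsto\overline g$ is the natural map $G\to\overline G$. For $1\le k\le\ell$: $S_k=\{\sigma_i:i\le k\}$, $G_k=\langle S_k\rangle N$, and $m_k=|\overline{G_k}:\overline{G_{k-1}}|$ (for $k\ge 2$). $X^{\pm1}=X\cup X^{ -1}$. $[a,s]=a^{ -1}s^{ -1}as$. $\mathrm{Cay}(\overline{G_k};\overline{S_k})$ has vertex set $\overline{G_k}$ and edges $\overline g$—$\overline{gs}$, $s\in S_k$. An oriented hamiltonian cycle in it is given by a starting vertex $\overline g$ and a sequence $(s_1,\dots,s_n)$ in $S_k^{\pm1}$, $n=|\overline{G_k}|$, such that $\overline g,\overline{gs_1},\dots,\overline{gs_1\cdots s_n}$ visits every vertex exactly once before returning to $\overline g$; its voltage is $s_1\cdots s_n\in N$. It covers $S_k^{\pm1}$ if for every $s\in S_k$ there are indices $i\ne j$ with $s_i=s$ and $s_j=s^{ -1}$. $\mathcal V_k$ is the set of voltages of oriented hamiltonian cycles in $\mathrm{Cay}(\overline{G_k};\overline{S_k})$ that cover $S_k^{\pm1}$. -}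

module Defs where

open import Level using (Level; _⊔_)
open import Algebra.Bundles using (Group)
open import Data.Nat using (ℕ; zero; suc; _<_; _≤_)
open import Data.Integer using (ℤ; +_; -[1+_])
open import Data.Product using (Σ; ∃; _×_; _,_)
open import Data.Sum using (_⊎_)
open import Data.Bool using (Bool; true; false)
open import Data.List using (List)
open import Data.List.Relation.Unary.Any using (Any)
open import Relation.Nullary using (¬_)
open import Relation.Binary.PropositionalEquality using (_≡_; _≢_)

module GroupDefs {c ℓ : Level} (G : Group c ℓ) where
  open Group G

  Subset : Set (Level.suc (c ⊔ ℓ))
  Subset = Carrier → Set (c ⊔ ℓ)

  IsFinite : Set (c ⊔ ℓ)
  IsFinite = Σ (List Carrier) λ xs → ∀ x → Any (x ≈_) xs

  ⟦_,_⟧ : Carrier → Carrier → Carrier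
  ⟦ a , s ⟧ = ((a ⁻¹ ∙ s ⁻¹) ∙ a) ∙ s

  powℕ : Carrier → ℕ → Carrier
  powℕ x zero = ε
  powℕ x (suc n) = powℕ x n ∙ x

  powℤ : Carrier → ℤ → Carrier
  powℤ x (+ n) = powℕ x n
  powℤ x -[1+ n ] = (powℕ x (suc n)) ⁻¹

  prod : ℕ → (ℕ → Carrier) → Carrier
  prod zero f = ε
  prod (suc n) f = prod n f ∙ f n

  data Gen (P : Subset) : Subset where
    gen  : ∀ {x} → P x → Gen P x
    gen-ε : Gen P ε
    gen-∙ : ∀ {x y} → Gen P x → Gen P y → Gen P (x ∙ y)
    gen-⁻¹ : ∀ {x} → Gen P x → Gen P (x ⁻¹)
    gen-≈ : ∀ {x y} → x ≈ y → Gen P x → Gen P y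

  _∪_ : Subset → Subset → Subset
  (P ∪ Q) x = P x ⊎ Q x

  IsSubgroup : Subset → Set (c ⊔ ℓ)
  IsSubgroup H =
    (∀ {x y} → x ≈ y → H x → H y) ×
    H ε ×
    (∀ {x y} → H x → H y → H (x ∙ y)) ×
    (∀ {x} → H x → H (x ⁻¹))

  IsNormalSubgroup : Subset → Set (c ⊔ ℓ)
  IsNormalSubgroup H = IsSubgroup H × (∀ g {x} → H x → H ((g ⁻¹ ∙ x) ∙ g))

  IsCyclic : Subset → Set (c ⊔ ℓ)
  IsCyclic H = Σ Carrier λ z → H z × (∀ {x} → H x → Σ ℤ λ t → x ≈ powℤ z t)

  DerivedSubgroup : Subset
  DerivedSubgroup = Gen (λ x → Σ Carrier λ y → Σ Carrier λ z → x ≈ ⟦ y , z ⟧)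

  _⊆_ : Subset → Subset → Set (c ⊔ ℓ)
  P ⊆ Q = ∀ {x} → P x → Q x

  Central : Subset → Set (c ⊔ ℓ)
  Central H = ∀ {x} → H x → ∀ g → x ∙ g ≈ g ∙ x

  γ : ℕ → Subset
  γ zero x = Level.Lift (c ⊔ ℓ) Data.Unit.⊤
    where import Data.Unit
  γ (suc i) = Gen (λ x → Σ Carrier λ y → Σ Carrier λ z → γ i y × x ≈ ⟦ y , z ⟧)

  IsNilpotent : Set (c ⊔ ℓ)
  IsNilpotent = Σ ℕ λ n → ∀ {x} → γ n x → x ≈ ε

  -- Notions relative to a normal subgroup N and a sequence σ 0, σ 1, …
  -- (σ i here is σ_{i+1} of the paper; S = {σ i : i < ℓ}).
  module WithN (N : Subset) (σ : ℕ → Carrier) where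

    -- congruence modulo N: x̄ = ȳ in Ḡ = G/N
    _~_ : Carrier → Carrier → Set (c ⊔ ℓ)
    x ~ y = N (x ⁻¹ ∙ y)

    S : ℕ → Subset
    S k x = Level.Lift (c ⊔ ℓ) (Σ ℕ λ i → i < k × x ≈ σ i)

    Gk : ℕ → Subset
    Gk k = Gen (S k ∪ N)

    -- S̄ (with #S = #S̄ = ℓ) is a minimal generating set of Ḡ
    DistinctModN : ℕ → Set (c ⊔ ℓ)
    DistinctModN ℓ' = ∀ i j → i < ℓ' → j < ℓ' → σ i ~ σ j → i ≡ j

    GeneratesModN : (ℕ → Bool) → ℕ → Set (c ⊔ ℓ)
    GeneratesModN T ℓ' =
      ∀ g → Gen ((λ x → Level.Lift (c ⊔ ℓ) (Σ ℕ λ i → i < ℓ' × T i ≡ true × x ≈ σ i)) ∪ N) g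

    MinimalGeneratingModN : ℕ → Set (c ⊔ ℓ)
    MinimalGeneratingModN ℓ' =
      GeneratesModN (λ _ → true) ℓ' ×
      (∀ (T : ℕ → Bool) → Σ ℕ (λ i → i < ℓ' × T i ≡ false) → ¬ GeneratesModN T ℓ')

    -- |Ḡ_{k+1} : Ḡ_k| = m  (counted via left cosets of G_k in G_{k+1}; N ⊆ G_k)
    IsIndex : Subset → Subset → ℕ → Set (c ⊔ ℓ)
    IsIndex H K m =
      Σ (ℕ → Carrier) λ t →
        (∀ j → j < m → H (t j)) ×
        (∀ {h} → H h → Σ ℕ λ j → j < m × K (t j ⁻¹ ∙ h)) ×
        (∀ {h} j j' → j < m → j' < m → K (t j ⁻¹ ∙ h) → K (t j' ⁻¹ ∙ h) → j ≡ j')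

    -- oriented hamiltonian cycle in Cay(Ḡ_k; S̄_k): start vertex g, steps s 0 … s (n-1)
    record HamCycle (k : ℕ) : Set (c ⊔ ℓ) where
      field
        n      : ℕ
        start  : Carrier
        start∈ : Gk k start
        step   : ℕ → Carrier
        step∈  : ∀ i → i < n → Σ ℕ λ j → j < k × (step i ≈ σ j ⊎ step i ≈ σ j ⁻¹)
      vertex : ℕ → Carrier
      vertex j = start ∙ prod j step
      field
        distinct : ∀ i j → i < n → j < n → vertex i ~ vertex j → i ≡ j
        onto     : ∀ {h} → Gk k h → Σ ℕ λ j → j < n × vertex j ~ h
        closes   : vertex n ~ start
      voltage : Carrier
      voltage = prod n step
      Covers : Set ℓ
      Covers = ∀ j → j < k → Σ ℕ λ p → Σ ℕ λ q →
                 p < n × q < n × p ≢ q × step p ≈ σ j × step q ≈ σ j ⁻¹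

    𝒱 : ℕ → Subset
    𝒱 k x = Σ (HamCycle k) λ C → HamCycle.Covers C × HamCycle.voltage C ≈ x

module Submission where

-- Coset aⁱG_k is traversed by the
-- cycle π_i, rotated and translated to start anywhere in the coset.  Working
-- down from the last coset, the cycle of aⁱG_k loses its step (s*_{i-1})⁻¹
-- and its step s*_i is replaced by the detour a · (path through the later
-- cosets) · a⁻¹; the cycle of G_k itself has s*_0 replaced by such a detour.
-- Because N ⊇ G' is central, each detour multiplies the voltage by the
-- central element π_{i+1}⋯[a, s*_i], which gives the stated voltage.

open import Defs
open import Level using (Level; _⊔_)
open import Algebra.Bundles using (Group)
open import Data.Nat using (ℕ; suc; _<_; _≤_; _∸_)
open import Data.Product using (Σ; _×_)
open import Data.Sum using (_⊎_)

open import Data.Nat using (zero; _+_; z≤n; s≤s; _≟_)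
open import Data.Nat.Properties
  using (+-identityʳ; +-suc; <-trans; <-≤-trans; ≤-<-trans; <-irrefl; <-cmp; <⇒≤; m≤m+n; +-monoʳ-<; ∸-monoˡ-<;
         m+[n∸m]≡n; m≤n⇒m⊓n≡m; m<n⇒m<1+n;
         n<1+n; m<1+n⇒m<n∨m≡n; _<?_; ≮⇒≥; +-cancelˡ-<; +-mono-<; ∸-monoʳ-<; m∸n+n≡m;
         n∸n≡0; ≤-refl; ≤-trans; m∸n≤m; ≤-pred; <⇒≢; ≤-antisym; <⇒≤pred; pred[m∸n]≡m∸[1+n]; ≤∧≢⇒<; m<m+n; ≤-reflexive)
open import Data.Product using (_,_; proj₁; proj₂)
open import Data.Sum as Sum using (inj₁; inj₂; [_,_]′)
open import Data.Empty using (⊥-elim)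
open import Function using (_∘_)
open import Data.Bool using (Bool; true; false)
open import Data.Fin using (Fin; toℕ; fromℕ<)
open import Data.Fin.Properties using (pigeonhole; toℕ<n; toℕ-fromℕ<)
import Data.List as List
open import Data.List using (List; []; _∷_; _++_; [_]; length; take; drop; applyUpTo)
open import Data.List.Properties using (++-assoc; applyUpTo-∷ʳ; length-applyUpTo; map-++; length-++; length-take; length-drop)
open import Data.List.Relation.Unary.All as All using (All; []; _∷_)
import Data.List.Relation.Unary.All.Properties as AllP
open import Data.List.Relation.Unary.Any as Any using (Any; here; there)
open import Data.List.Relation.Unary.Any.Properties as AnyP using (++⁺ˡ; ++⁺ʳ)
open import Data.List.Relation.Unary.AllPairs as AllPairs using (AllPairs; []; _∷_)
import Data.List.Relation.Unary.AllPairs.Properties as AllPairsP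
open import Data.List.Relation.Binary.Pointwise as PW using (Pointwise; []; _∷_)
open import Relation.Nullary using (¬_; Dec; yes; no)
open import Relation.Binary.Definitions using (tri<; tri≈; tri>)
import Relation.Binary.PropositionalEquality as ≡
open ≡ using (_≡_; _≢_)

-- Hamiltonian cycles are handled as lists of steps; positions are
-- natural numbers, read off with the default-valued lookup `at`.

module ListFacts {a : Level} {A : Set a} where
  open ≡ using (refl; sym; trans; cong; subst)

  at : A → List A → ℕ → A
  at d []       _       = d
  at d (x ∷ xs) zero    = x
  at d (x ∷ xs) (suc p) = at d xs p

  at-applyUpTo : ∀ d (f : ℕ → A) n p → p < n → at d (applyUpTo f n) p ≡ f p
  at-applyUpTo d f (suc n) zero    _         = refl
  at-applyUpTo d f (suc n) (suc p) (s≤s p<n) = at-applyUpTo d (λ j → f (suc j)) n p p<n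

  applyUpTo-at : ∀ d (xs : List A) → xs ≡ applyUpTo (at d xs) (length xs)
  applyUpTo-at d []       = refl
  applyUpTo-at d (x ∷ xs) = cong (x ∷_) (applyUpTo-at d xs)

  at-All : ∀ {q} {Q : A → Set q} d {xs} → All Q xs → ∀ p → p < length xs → Q (at d xs p)
  at-All d (qx ∷ _)  zero    _         = qx
  at-All d (_ ∷ qxs) (suc p) (s≤s p<n) = at-All d qxs p p<n

  at-Any : ∀ {q} {Q : A → Set q} d xs p → p < length xs → Q (at d xs p) → Any Q xs
  at-Any d (x ∷ xs) zero    _         qx = here qx
  at-Any d (x ∷ xs) (suc p) (s≤s p<n) qx = there (at-Any d xs p p<n qx)

  Any-at : ∀ {q} {Q : A → Set q} d {xs} → Any Q xs → Σ ℕ λ p → p < length xs × Q (at d xs p)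
  Any-at d (here qx)  = 0 , s≤s z≤n , qx
  Any-at d (there qx) with p , p<n , qp ← Any-at d qx = suc p , s≤s p<n , qp

  at-++ˡ : ∀ d (xs ys : List A) p → p < length xs → at d (xs ++ ys) p ≡ at d xs p
  at-++ˡ d (x ∷ xs) ys zero    _         = refl
  at-++ˡ d (x ∷ xs) ys (suc p) (s≤s p<n) = at-++ˡ d xs ys p p<n

  at-++ʳ : ∀ d (xs ys : List A) p → at d (xs ++ ys) (length xs + p) ≡ at d ys p
  at-++ʳ d []       ys p = refl
  at-++ʳ d (x ∷ xs) ys p = at-++ʳ d xs ys p

  at-take : ∀ d (t : List A) p s → s < p → at d (take p t) s ≡ at d t s
  at-take d []      (suc p) s       _         = refl
  at-take d (x ∷ t) (suc p) zero    _         = refl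
  at-take d (x ∷ t) (suc p) (suc s) (s≤s s<p) = at-take d t p s s<p

  at-drop : ∀ d (t : List A) n j → at d (drop n t) j ≡ at d t (n + j)
  at-drop d t       zero    j = refl
  at-drop d []      (suc n) j = refl
  at-drop d (x ∷ t) (suc n) j = at-drop d t n j

  AllPairs-applyUpTo⁻ : ∀ {r} {R : A → A → Set r} (f : ℕ → A) n → AllPairs R (applyUpTo f n) →
                        ∀ {i j} → i < j → j < n → R (f i) (f j)
  AllPairs-applyUpTo⁻ f (suc n) (r₀ ∷ rs) {zero}  {suc j} _         (s≤s j<n) =
    AllP.applyUpTo⁻ (λ i → f (suc i)) n r₀ j<n
  AllPairs-applyUpTo⁻ f (suc n) (r₀ ∷ rs) {suc i} {suc j} (s≤s i<j) (s≤s j<n) =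
    AllPairs-applyUpTo⁻ (λ i → f (suc i)) n rs i<j j<n

  record TwoSites {q₁ q₂} (Q₁ : A → Set q₁) (Q₂ : A → Set q₂) (d : A) (t : List A)
                  : Set (a ⊔ q₁ ⊔ q₂) where
    constructor sites
    field
      p₁ p₂     : ℕ
      p₁<       : p₁ < length t
      p₂<       : p₂ < length t
      p₁≢p₂     : p₁ ≢ p₂
      at₁       : Q₁ (at d t p₁)
      at₂       : Q₂ (at d t p₂)

  swapSites : ∀ {q₁ q₂} {Q₁ : A → Set q₁} {Q₂ : A → Set q₂} {d t} →
              TwoSites Q₁ Q₂ d t → TwoSites Q₂ Q₁ d t
  swapSites (sites p₁ p₂ p₁< p₂< ne q₁ q₂) = sites p₂ p₁ p₂< p₁< (λ e → ne (sym e)) q₂ q₁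

  sites-++ : ∀ {q₁ q₂} {Q₁ : A → Set q₁} {Q₂ : A → Set q₂} d xs ys →
             Any Q₁ xs → Any Q₂ ys → TwoSites Q₁ Q₂ d (xs ++ ys)
  sites-++ {Q₁ = Q₁} {Q₂} d xs ys a₁ a₂ with p , p< , qp ← Any-at d a₁ | r , r< , qr ← Any-at d a₂ =
    sites p (length xs + r) (subst (p <_) (sym len) (<-≤-trans p< (m≤m+n _ _)))
          (subst (length xs + r <_) (sym len) (+-monoʳ-< (length xs) r<))
          (λ e → <-irrefl refl (<-≤-trans (subst (_< length xs) e p<) (m≤m+n _ _)))
          (subst Q₁ (sym (at-++ˡ d xs ys p p<)) qp)
          (subst Q₂ (sym (at-++ʳ d xs ys r)) qr)
    where len : length (xs ++ ys) ≡ length xs + length ys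
          len = length-++ xs

  split-at : ∀ d (t : List A) p → p < length t → t ≡ take p t ++ at d t p ∷ drop (suc p) t
  split-at d (x ∷ t) zero    _         = refl
  split-at d (x ∷ t) (suc p) (s≤s p<n) = cong (x ∷_) (split-at d t p p<n)

  survives-split : ∀ {q} {Q : A → Set q} d (t : List A) p s → s < length t → s ≢ p → Q (at d t s) →
                   Any Q (take p t) ⊎ Any Q (drop (suc p) t)
  survives-split d (x ∷ t) zero    zero    _         s≢p _  = ⊥-elim (s≢p refl)
  survives-split d (x ∷ t) zero    (suc s) (s≤s s<n) _   qs = inj₂ (at-Any d t s s<n qs)
  survives-split d (x ∷ t) (suc p) zero    _         _   qs = inj₁ (here qs)
  survives-split d (x ∷ t) (suc p) (suc s) (s≤s s<n) s≢p qs =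
    Sum.map₁ there (survives-split d t p s s<n (λ e → s≢p (cong suc e)) qs)

  module Cutting (d : A) {q : Level} where

    split-at₂ : ∀ (t : List A) p r → p < r → r < length t →
      t ≡ take p t ++ at d t p ∷ (take (r ∸ suc p) (drop (suc p) t) ++
            at d t r ∷ drop (suc (r ∸ suc p)) (drop (suc p) t))
    split-at₂ t p r p<r r<n =
      trans (split-at d t p (<-trans p<r r<n)) (cong (λ z → take p t ++ at d t p ∷ z) splitD)
      where
        D : List A
        D = drop (suc p) t
        r' : ℕ
        r' = r ∸ suc p
        r'<D : r' < length D
        r'<D = subst (r' <_) (sym (length-drop (suc p) t)) (∸-monoˡ-< r<n p<r)
        entry : at d D r' ≡ at d t r
        entry = trans (at-drop d t (suc p) r') (cong (at d t) (m+[n∸m]≡n p<r))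
        splitD : D ≡ take r' D ++ at d t r ∷ drop (suc r') D
        splitD = trans (split-at d D r' r'<D) (cong (λ z → take r' D ++ z ∷ drop (suc r') D) entry)

    survives-split₂ : ∀ (Q : A → Set q) (t : List A) p r s → p < r → r < length t → s < length t →
      s ≢ p → s ≢ r → Q (at d t s) →
      Any Q (take p t) ⊎ Any Q (take (r ∸ suc p) (drop (suc p) t)) ⊎
        Any Q (drop (suc (r ∸ suc p)) (drop (suc p) t))
    survives-split₂ Q t p r s p<r r<n s<n s≢p s≢r qs with <-cmp s p
    ... | tri≈ _ s≡p _ = ⊥-elim (s≢p s≡p)
    ... | tri< s<p _ _ = inj₁ (at-Any d (take p t) s s<take (subst Q (sym (at-take d t p s s<p)) qs))
      where s<take : s < length (take p t)
            s<take = subst (s <_) (sym (trans (length-take p t) (m≤n⇒m⊓n≡m (<⇒≤ (<-trans p<r r<n))))) s<p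
    ... | tri> _ _ p<s = inj₂ (survives-split d D r' s' s'<D s'≢r' qs')
      where
        D : List A
        D = drop (suc p) t
        r' s' : ℕ
        r' = r ∸ suc p
        s' = s ∸ suc p
        s'<D : s' < length D
        s'<D = subst (s' <_) (sym (length-drop (suc p) t)) (∸-monoˡ-< s<n p<s)
        s'≢r' : s' ≢ r'
        s'≢r' e = s≢r (trans (sym (m+[n∸m]≡n p<s)) (trans (cong (suc p +_) e) (m+[n∸m]≡n p<r)))
        qs' : Q (at d D s')
        qs' = subst Q (sym (trans (at-drop d t (suc p) s') (cong (at d t) (m+[n∸m]≡n p<s)))) qs

    record CutOne (t : List A) (r : ℕ) : Set (a ⊔ Level.suc q) where
      field
        rest X Y : List A
        t≡XY     : t ≡ X ++ Y
        YX≡      : Y ++ X ≡ rest ++ [ at d t r ]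
        survives : ∀ (Q : A → Set q) s → s < length t → s ≢ r → Q (at d t s) → Any Q rest

    cutOne : ∀ t r → r < length t → CutOne t r
    cutOne t r r<n = record
      { rest = W ++ U ; X = U ++ [ e ] ; Y = W
      ; t≡XY = trans (split-at d t r r<n) (sym (++-assoc U [ e ] W))
      ; YX≡ = sym (++-assoc W U [ e ])
      ; survives = λ Q s s<n s≢r qs → [ ++⁺ʳ W , ++⁺ˡ ]′ (survives-split d t r s s<n s≢r qs) }
      where
        U W : List A
        U = take r t
        W = drop (suc r) t
        e : A
        e = at d t r

    survivors : ∀ {t r} (K : CutOne t r) {Q₁ Q₂ : A → Set q} → TwoSites Q₁ Q₂ d t →
      (Any Q₁ (CutOne.rest K) × Any Q₂ (CutOne.rest K)) ⊎
      (Q₁ (at d t r) × Any Q₂ (CutOne.rest K)) ⊎ (Q₂ (at d t r) × Any Q₁ (CutOne.rest K))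
    survivors {r = r} K {Q₁} {Q₂} (sites p₁ p₂ p₁< p₂< p₁≢p₂ q₁ q₂) with p₁ ≟ r | p₂ ≟ r
    ... | yes refl | _ = inj₂ (inj₁ (q₁ , CutOne.survives K Q₂ p₂ p₂< (λ e → p₁≢p₂ (sym e)) q₂))
    ... | no p₁≢r | yes refl = inj₂ (inj₂ (q₂ , CutOne.survives K Q₁ p₁ p₁< p₁≢r q₁))
    ... | no p₁≢r | no p₂≢r =
      inj₁ (CutOne.survives K Q₁ p₁ p₁< p₁≢r q₁ , CutOne.survives K Q₂ p₂ p₂< p₂≢r q₂)

    record CutTwo (t : List A) (r₁ r₂ : ℕ) : Set (a ⊔ Level.suc q) where
      field
        left right X Y : List A
        t≡XY     : t ≡ X ++ Y
        YX≡      : Y ++ X ≡ left ++ at d t r₂ ∷ right ++ [ at d t r₁ ]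
        survives : ∀ (Q : A → Set q) s → s < length t → s ≢ r₁ → s ≢ r₂ → Q (at d t s) →
                   Any Q left ⊎ Any Q right

    cutTwo : ∀ t r₁ r₂ → r₁ < length t → r₂ < length t → r₁ ≢ r₂ → CutTwo t r₁ r₂
    cutTwo t r₁ r₂ r₁<n r₂<n r₁≢r₂ with <-cmp r₁ r₂
    ... | tri≈ _ e _ = ⊥-elim (r₁≢r₂ e)
    ... | tri< r₁<r₂ _ _ = record
      { left = V ; right = W ++ U ; X = U ++ [ e₁ ] ; Y = V ++ e₂ ∷ W
      ; t≡XY = trans (split-at₂ t r₁ r₂ r₁<r₂ r₂<n) (sym (++-assoc U [ e₁ ] (V ++ e₂ ∷ W)))
      ; YX≡ = trans (++-assoc V (e₂ ∷ W) (U ++ [ e₁ ]))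
                    (cong (λ z → V ++ e₂ ∷ z) (sym (++-assoc W U [ e₁ ])))
      ; survives = λ Q s s<n s≢r₁ s≢r₂ qs →
          [ (λ u → inj₂ (++⁺ʳ W u)) , [ inj₁ , (λ w → inj₂ (++⁺ˡ w)) ]′ ]′
            (survives-split₂ Q t r₁ r₂ s r₁<r₂ r₂<n s<n s≢r₁ s≢r₂ qs) }
      where
        U D V W : List A
        U = take r₁ t ; D = drop (suc r₁) t
        V = take (r₂ ∸ suc r₁) D ; W = drop (suc (r₂ ∸ suc r₁)) D
        e₁ e₂ : A
        e₁ = at d t r₁ ; e₂ = at d t r₂
    ... | tri> _ _ r₂<r₁ = record
      { left = W ++ U ; right = V ; X = U ++ e₂ ∷ V ++ [ e₁ ] ; Y = W
      ; t≡XY = trans (split-at₂ t r₂ r₁ r₂<r₁ r₁<n)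
                 (trans (cong (λ z → U ++ e₂ ∷ z) (sym (++-assoc V [ e₁ ] W)))
                        (sym (++-assoc U (e₂ ∷ V ++ [ e₁ ]) W)))
      ; YX≡ = sym (++-assoc W U _)
      ; survives = λ Q s s<n s≢r₁ s≢r₂ qs →
          [ (λ u → inj₁ (++⁺ʳ W u)) , [ inj₂ , (λ w → inj₁ (++⁺ˡ w)) ]′ ]′
            (survives-split₂ Q t r₂ r₁ s r₂<r₁ r₁<n s<n s≢r₂ s≢r₁ qs) }
      where
        U D V W : List A
        U = take r₂ t ; D = drop (suc r₂) t
        V = take (r₁ ∸ suc r₂) D ; W = drop (suc (r₁ ∸ suc r₂)) D
        e₁ e₂ : A
        e₁ = at d t r₁ ; e₂ = at d t r₂

    locate : ∀ {t r₁ r₂} (K : CutTwo t r₁ r₂) (Q : A → Set q) s → s < length t → Q (at d t s) →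
             s ≡ r₁ ⊎ s ≡ r₂ ⊎ Any Q (CutTwo.left K) ⊎ Any Q (CutTwo.right K)
    locate {r₁ = r₁} {r₂} K Q s s< qs with s ≟ r₁ | s ≟ r₂
    ... | yes s≡r₁ | _         = inj₁ s≡r₁
    ... | no _     | yes s≡r₂  = inj₂ (inj₁ s≡r₂)
    ... | no s≢r₁  | no s≢r₂   = inj₂ (inj₂ (CutTwo.survives K Q s s< s≢r₁ s≢r₂ qs))

  module Pairwise {r} (R : A → A → Set r) (R-sym : ∀ {x y} → R x y → R y x) where

    AllPairs-++⁻ : ∀ xs {ys} → AllPairs R (xs ++ ys) →
                   AllPairs R xs × AllPairs R ys × All (λ x → All (R x) ys) xs
    AllPairs-++⁻ []       rs        = [] , rs , []
    AllPairs-++⁻ (x ∷ xs) (rx ∷ rs) with AllPairs-++⁻ xs rs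
    ... | rxs , rys , cross = (AllP.++⁻ˡ xs rx ∷ rxs) , rys , (AllP.++⁻ʳ xs rx ∷ cross)

    private
      cross-swap : ∀ {xs ys} → All (λ x → All (R x) ys) xs → All (λ y → All (R y) xs) ys
      cross-swap c = All.map (All.map R-sym) (AllP.All-swap c)

    AllPairs-rotate : ∀ xs {ys} → AllPairs R (xs ++ ys) → AllPairs R (ys ++ xs)
    AllPairs-rotate xs rs with rxs , rys , cross ← AllPairs-++⁻ xs rs =
      AllPairsP.++⁺ rys rxs (cross-swap cross)

    AllPairs-insert : ∀ K₁ {K₂ M} → AllPairs R (K₁ ++ K₂) → AllPairs R M →
                      All (λ x → All (R x) M) (K₁ ++ K₂) → AllPairs R (K₁ ++ M ++ K₂)
    AllPairs-insert K₁ {K₂} {M} rs rM c with AllPairs-++⁻ K₁ rs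
    ... | r₁ , r₂ , c₁₂ =
      AllPairsP.++⁺ r₁ (AllPairsP.++⁺ rM r₂ (cross-swap (AllP.++⁻ʳ K₁ c)))
        (zipAll c₁₂ (AllP.++⁻ˡ K₁ c))
      where zipAll : ∀ {zs} → All (λ x → All (R x) K₂) zs → All (λ x → All (R x) M) zs →
                     All (λ x → All (R x) (M ++ K₂)) zs
            zipAll []       []       = []
            zipAll (p ∷ ps) (q ∷ qs) = AllP.++⁺ q p ∷ zipAll ps qs

  Any-insert : ∀ {q} {Q : A → Set q} K₁ {K₂} M → Any Q (K₁ ++ K₂) → Any Q (K₁ ++ M ++ K₂)
  Any-insert K₁ M = [ ++⁺ˡ , (λ k → ++⁺ʳ K₁ (++⁺ʳ M k)) ]′ ∘ AnyP.++⁻ K₁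

-- A walk from g with steps t₁ … tₙ visits g, g t₁, …, g t₁⋯tₙ.  `vertices`
-- lists all but the endpoint (for a closed walk: every vertex once),
-- `path` includes the endpoint.

module Walks {c ℓ : Level} (G : Group c ℓ) where
  open Group G
  open GroupDefs G
  open import Algebra.Properties.Group G
  open import Relation.Binary.Reasoning.Setoid setoid

  x⁻¹∙[x∙y]≈y : ∀ x y → x ⁻¹ ∙ (x ∙ y) ≈ y
  x⁻¹∙[x∙y]≈y = \\-leftDividesʳ

  x∙[x⁻¹∙y]≈y : ∀ x y → x ∙ (x ⁻¹ ∙ y) ≈ y
  x∙[x⁻¹∙y]≈y = \\-leftDividesˡ

  [y∙x]∙x⁻¹≈y : ∀ x y → (y ∙ x) ∙ x ⁻¹ ≈ y
  [y∙x]∙x⁻¹≈y = //-rightDividesʳ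

  [y∙x⁻¹]∙x≈y : ∀ x y → (y ∙ x ⁻¹) ∙ x ≈ y
  [y∙x⁻¹]∙x≈y = //-rightDividesˡ

  powℕ-+ : ∀ x i j → powℕ x (i + j) ≈ powℕ x i ∙ powℕ x j
  powℕ-+ x i zero rewrite +-identityʳ i = sym (identityʳ _)
  powℕ-+ x i (suc j) rewrite +-suc i j = begin
    powℕ x (i + j) ∙ x         ≈⟨ ∙-congʳ (powℕ-+ x i j) ⟩
    (powℕ x i ∙ powℕ x j) ∙ x  ≈⟨ assoc _ _ _ ⟩
    powℕ x i ∙ (powℕ x j ∙ x)  ∎

  powℕ-diff : ∀ x i d → powℕ x i ⁻¹ ∙ powℕ x (i + d) ≈ powℕ x d
  powℕ-diff x i d = trans (∙-congˡ (powℕ-+ x i d)) (x⁻¹∙[x∙y]≈y _ _)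

  Π : List Carrier → Carrier
  Π []       = ε
  Π (x ∷ xs) = x ∙ Π xs

  Π-++ : ∀ xs ys → Π (xs ++ ys) ≈ Π xs ∙ Π ys
  Π-++ []       ys = sym (identityˡ _)
  Π-++ (x ∷ xs) ys = trans (∙-congˡ (Π-++ xs ys)) (sym (assoc _ _ _))

  end : Carrier → List Carrier → Carrier
  end g []       = g
  end g (t ∷ ts) = end (g ∙ t) ts

  vertices : Carrier → List Carrier → List Carrier
  vertices g []       = []
  vertices g (t ∷ ts) = g ∷ vertices (g ∙ t) ts

  path : Carrier → List Carrier → List Carrier
  path g ts = vertices g ts ++ [ end g ts ]

  end≈ : ∀ g ts → end g ts ≈ g ∙ Π ts
  end≈ g []       = sym (identityʳ g)
  end≈ g (t ∷ ts) = trans (end≈ (g ∙ t) ts) (assoc _ _ _)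

  end-++ : ∀ g xs ys → end g (xs ++ ys) ≡ end (end g xs) ys
  end-++ g []       ys = ≡.refl
  end-++ g (x ∷ xs) ys = end-++ (g ∙ x) xs ys

  vertices-++ : ∀ g xs ys → vertices g (xs ++ ys) ≡ vertices g xs ++ vertices (end g xs) ys
  vertices-++ g []       ys = ≡.refl
  vertices-++ g (x ∷ xs) ys = ≡.cong (g ∷_) (vertices-++ (g ∙ x) xs ys)

  path-++ : ∀ g xs ys → path g (xs ++ ys) ≡ vertices g xs ++ path (end g xs) ys
  path-++ g xs ys rewrite vertices-++ g xs ys | end-++ g xs ys = ++-assoc (vertices g xs) _ _

  vertices-∷ʳ : ∀ g ts e → vertices g (ts ++ [ e ]) ≡ path g ts
  vertices-∷ʳ g ts e = vertices-++ g ts [ e ]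

  end-applyUpTo : ∀ g f n → end g (applyUpTo f n) ≈ g ∙ prod n f
  end-applyUpTo g f zero    = sym (identityʳ g)
  end-applyUpTo g f (suc n) = begin
    end g (applyUpTo f (suc n))          ≡⟨ ≡.cong (end g) (applyUpTo-∷ʳ f n) ⟨
    end g (applyUpTo f n ++ [ f n ])     ≡⟨ end-++ g (applyUpTo f n) [ f n ] ⟩
    end g (applyUpTo f n) ∙ f n          ≈⟨ ∙-congʳ (end-applyUpTo g f n) ⟩
    (g ∙ prod n f) ∙ f n                 ≈⟨ assoc _ _ _ ⟩
    g ∙ prod (suc n) f                   ∎

  Π-applyUpTo : ∀ f n → Π (applyUpTo f n) ≈ prod n f
  Π-applyUpTo f n = begin
    Π (applyUpTo f n)       ≈⟨ identityˡ _ ⟨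
    ε ∙ Π (applyUpTo f n)   ≈⟨ end≈ ε (applyUpTo f n) ⟨
    end ε (applyUpTo f n)   ≈⟨ end-applyUpTo ε f n ⟩
    ε ∙ prod n f            ≈⟨ identityˡ _ ⟩
    prod n f                ∎

  vertices-applyUpTo : ∀ g f n →
    vertices g (applyUpTo f n) ≡ applyUpTo (λ j → end g (applyUpTo f j)) n
  vertices-applyUpTo g f zero    = ≡.refl
  vertices-applyUpTo g f (suc n) =
    ≡.trans (≡.cong (vertices g) (≡.sym (applyUpTo-∷ʳ f n)))
   (≡.trans (vertices-++ g (applyUpTo f n) [ f n ])
   (≡.trans (≡.cong (_++ [ end g (applyUpTo f n) ]) (vertices-applyUpTo g f n))
            (applyUpTo-∷ʳ (λ j → end g (applyUpTo f j)) n)))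

module Setting {c ℓ : Level} (G : Group c ℓ) (N : GroupDefs.Subset G)
               (N-normal : GroupDefs.IsNormalSubgroup G N)
               (G'⊆N : GroupDefs._⊆_ G (GroupDefs.DerivedSubgroup G) N)
               (N-central : GroupDefs.Central G N) (σ : ℕ → Group.Carrier G) where
  open Group G
  open GroupDefs G
  open WithN N σ
  open Walks G
  open ListFacts using (at; TwoSites; sites; swapSites; at-applyUpTo; Any-insert)
  open import Algebra.Properties.Group G
  open import Relation.Binary.Reasoning.Setoid setoid hiding (start)
  open import Tactic.MonoidSolver using (solve)

  N-resp : ∀ {x y} → x ≈ y → N x → N y
  N-resp = proj₁ (proj₁ N-normal)

  N-ε : N ε
  N-ε = proj₁ (proj₂ (proj₁ N-normal))

  N-∙ : ∀ {x y} → N x → N y → N (x ∙ y)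
  N-∙ = proj₁ (proj₂ (proj₂ (proj₁ N-normal)))

  N-⁻¹ : ∀ {x} → N x → N (x ⁻¹)
  N-⁻¹ = proj₂ (proj₂ (proj₂ (proj₁ N-normal)))

  N-conj : ∀ g {x} → N x → N ((g ⁻¹ ∙ x) ∙ g)
  N-conj = proj₂ N-normal

  N-comm : ∀ x y → N ⟦ x , y ⟧
  N-comm x y = G'⊆N (gen (x , y , refl))

  ~-refl : ∀ {x} → x ~ x
  ~-refl {x} = N-resp (sym (inverseˡ x)) N-ε

  ≈⇒~ : ∀ {x y} → x ≈ y → x ~ y
  ≈⇒~ {x} e = N-resp (trans (sym (inverseˡ x)) (∙-congˡ e)) N-ε

  ~-sym : ∀ {x y} → x ~ y → y ~ x
  ~-sym {x} n = N-resp (trans (⁻¹-anti-homo-∙ _ _) (∙-congˡ (⁻¹-involutive x))) (N-⁻¹ n)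

  ~-trans : ∀ {x y z} → x ~ y → y ~ z → x ~ z
  ~-trans {x} {y} {z} n₁ n₂ = N-resp (trans (assoc _ _ _) (∙-congˡ (x∙[x⁻¹∙y]≈y y z))) (N-∙ n₁ n₂)

  ~-resp : ∀ {x x' y y'} → x ≈ x' → y ≈ y' → x ~ y → x' ~ y'
  ~-resp e₁ e₂ n = ~-trans (~-sym (≈⇒~ e₁)) (~-trans n (≈⇒~ e₂))

  ∙-~ˡ : ∀ z {x y} → x ~ y → (z ∙ x) ~ (z ∙ y)
  ∙-~ˡ z {x} {y} = N-resp (sym (begin
    (z ∙ x) ⁻¹ ∙ (z ∙ y)         ≈⟨ ∙-congʳ (⁻¹-anti-homo-∙ z x) ⟩
    (x ⁻¹ ∙ z ⁻¹) ∙ (z ∙ y)      ≈⟨ assoc _ _ _ ⟩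
    x ⁻¹ ∙ (z ⁻¹ ∙ (z ∙ y))      ≈⟨ ∙-congˡ (x⁻¹∙[x∙y]≈y z y) ⟩
    x ⁻¹ ∙ y                     ∎))

  ∙-~ˡ⁻ : ∀ z {x y} → (z ∙ x) ~ (z ∙ y) → x ~ y
  ∙-~ˡ⁻ z n = ~-resp (x⁻¹∙[x∙y]≈y z _) (x⁻¹∙[x∙y]≈y z _) (∙-~ˡ (z ⁻¹) n)

  ∙-~ʳ : ∀ z {x y} → x ~ y → (x ∙ z) ~ (y ∙ z)
  ∙-~ʳ z {x} {y} n = N-resp (begin
    (z ⁻¹ ∙ (x ⁻¹ ∙ y)) ∙ z   ≈⟨ solve monoid ⟩
    (z ⁻¹ ∙ x ⁻¹) ∙ (y ∙ z)   ≈⟨ ∙-congʳ (⁻¹-anti-homo-∙ x z) ⟨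
    (x ∙ z) ⁻¹ ∙ (y ∙ z)      ∎) (N-conj z n)

  N-absorb : ∀ {n} y → N n → (n ∙ y) ~ y
  N-absorb {n} y nn = N-resp (∙-congʳ (sym (⁻¹-anti-homo-∙ n y))) (N-conj y (N-⁻¹ nn))

  N⇒~ε : ∀ {x} → N x → x ~ ε
  N⇒~ε n = N-resp (sym (identityʳ _)) (N-⁻¹ n)

  _~ᴸ_ : List Carrier → List Carrier → Set (c ⊔ ℓ)
  _~ᴸ_ = Pointwise _~_

  ~ᴸ-refl : ∀ {xs} → xs ~ᴸ xs
  ~ᴸ-refl = PW.refl ~-refl

  ~ᴸ-sym : ∀ {xs ys} → xs ~ᴸ ys → ys ~ᴸ xs
  ~ᴸ-sym = PW.symmetric ~-sym

  ~ᴸ-trans : ∀ {xs ys zs} → xs ~ᴸ ys → ys ~ᴸ zs → xs ~ᴸ zs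
  ~ᴸ-trans = PW.transitive ~-trans

  ≡⇒~ᴸ : ∀ {xs ys} → xs ≡ ys → xs ~ᴸ ys
  ≡⇒~ᴸ ≡.refl = ~ᴸ-refl

  end-~ : ∀ {g g'} ts → g ~ g' → end g ts ~ end g' ts
  end-~ []       e = e
  end-~ (t ∷ ts) e = end-~ ts (∙-~ʳ t e)

  vertices-~ : ∀ {g g'} ts → g ~ g' → vertices g ts ~ᴸ vertices g' ts
  vertices-~ []       e = []
  vertices-~ (t ∷ ts) e = e ∷ vertices-~ ts (∙-~ʳ t e)

  path-~ : ∀ {g g'} ts → g ~ g' → path g ts ~ᴸ path g' ts
  path-~ ts e = PW.++⁺ (vertices-~ ts e) (end-~ ts e ∷ [])

  vertices-translate : ∀ c g ts → vertices (c ∙ g) ts ~ᴸ List.map (c ∙_) (vertices g ts)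
  vertices-translate c g []       = []
  vertices-translate c g (t ∷ ts) =
    ~-refl ∷ ~ᴸ-trans (vertices-~ ts (≈⇒~ (assoc c g t))) (vertices-translate c (g ∙ t) ts)

  _≁_ : Carrier → Carrier → Set (c ⊔ ℓ)
  x ≁ y = ¬ (x ~ y)

  ≁-sym : ∀ {x y} → x ≁ y → y ≁ x
  ≁-sym n e = n (~-sym e)

  Distinct : List Carrier → Set (c ⊔ ℓ)
  Distinct = AllPairs _≁_

  ≁-respʳ : ∀ {x y z} → y ~ z → x ≁ y → x ≁ z
  ≁-respʳ y~z x≁y x~z = x≁y (~-trans x~z (~-sym y~z))

  ≁-respˡ : ∀ {x y z} → y ~ z → y ≁ x → z ≁ x
  ≁-respˡ y~z y≁x z~x = y≁x (~-trans y~z z~x)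

  Distinct-~ᴸ : ∀ {xs ys} → Distinct xs → xs ~ᴸ ys → Distinct ys
  Distinct-~ᴸ d e = PW.AllPairs-resp-Pointwise (≁-respʳ , ≁-respˡ) e d

  Visits : Carrier → List Carrier → Set (c ⊔ ℓ)
  Visits h = Any (_~ h)

  Visits-~ᴸ : ∀ {h xs ys} → Visits h xs → xs ~ᴸ ys → Visits h ys
  Visits-~ᴸ v e = PW.Any-resp-Pointwise (λ x~y x~h → ~-trans (~-sym x~y) x~h) e v

  open ListFacts.Pairwise _≁_ ≁-sym public

  Gen-map : ∀ {P Q : Subset} → (∀ {x} → P x → Gen Q x) → ∀ {x} → Gen P x → Gen Q x
  Gen-map f (gen p)     = f p
  Gen-map f gen-ε       = gen-ε
  Gen-map f (gen-∙ p q) = gen-∙ (Gen-map f p) (Gen-map f q)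
  Gen-map f (gen-⁻¹ p)  = gen-⁻¹ (Gen-map f p)
  Gen-map f (gen-≈ e p) = gen-≈ e (Gen-map f p)

  N⊆Gk : ∀ k {x} → N x → Gk k x
  N⊆Gk k n = gen (inj₂ n)

  σ∈Gk : ∀ {j k} → j < k → Gk k (σ j)
  σ∈Gk {j} j<k = gen (inj₁ (Level.lift (j , j<k , refl)))

  -- G_k is normal, because G' ⊆ N ⊆ G_k.
  Gk-conj : ∀ k g {x} → Gk k x → Gk k ((g ⁻¹ ∙ x) ∙ g)
  Gk-conj k g {x} p = gen-≈ (begin
    x ∙ (((x ⁻¹ ∙ g ⁻¹) ∙ x) ∙ g)      ≈⟨ solve monoid ⟩
    (x ∙ x ⁻¹) ∙ ((g ⁻¹ ∙ x) ∙ g)      ≈⟨ ∙-congʳ (inverseʳ x) ⟩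
    ε ∙ ((g ⁻¹ ∙ x) ∙ g)               ≈⟨ identityˡ _ ⟩
    (g ⁻¹ ∙ x) ∙ g                     ∎) (gen-∙ p (N⊆Gk k (N-comm x g)))

  Step : ℕ → Carrier → Set ℓ
  Step k s = Σ ℕ λ j → j < k × (s ≈ σ j ⊎ s ≈ σ j ⁻¹)

  Step⇒Gk : ∀ {k s} → Step k s → Gk k s
  Step⇒Gk (j , j<k , inj₁ e) = gen-≈ (sym e) (σ∈Gk j<k)
  Step⇒Gk (j , j<k , inj₂ e) = gen-≈ (sym e) (gen-⁻¹ (σ∈Gk j<k))

  Step-suc : ∀ {k s} → Step k s → Step (suc k) s
  Step-suc (j , j<k , e) = j , m<n⇒m<1+n j<k , e

  Step-⁻¹ : ∀ {k s} → Step k s → Step k (s ⁻¹)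
  Step-⁻¹ (j , j<k , inj₁ e) = j , j<k , inj₂ (⁻¹-cong e)
  Step-⁻¹ (j , j<k , inj₂ e) = j , j<k , inj₁ (trans (⁻¹-cong e) (⁻¹-involutive _))

  -- Conjugating by a: since [a, y] is central, a y a⁻¹ = y [a, y].
  conj-by : ∀ a y → (a ∙ y) ∙ a ⁻¹ ≈ y ∙ ⟦ a , y ⟧
  conj-by a y = begin
    (a ∙ y) ∙ a ⁻¹                                   ≈⟨ x∙[x⁻¹∙y]≈y y _ ⟨
    y ∙ (y ⁻¹ ∙ ((a ∙ y) ∙ a ⁻¹))                    ≈⟨ ∙-congˡ (identityˡ _) ⟨
    y ∙ (ε ∙ (y ⁻¹ ∙ ((a ∙ y) ∙ a ⁻¹)))              ≈⟨ ∙-congˡ (∙-congʳ (inverseʳ a)) ⟨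
    y ∙ ((a ∙ a ⁻¹) ∙ (y ⁻¹ ∙ ((a ∙ y) ∙ a ⁻¹)))     ≈⟨ solve monoid ⟩
    y ∙ ((a ∙ ⟦ a , y ⟧) ∙ a ⁻¹)                     ≈⟨ ∙-congˡ (∙-congʳ (N-central (N-comm a y) a)) ⟨
    y ∙ ((⟦ a , y ⟧ ∙ a) ∙ a ⁻¹)                     ≈⟨ ∙-congˡ ([y∙x]∙x⁻¹≈y a _) ⟩
    y ∙ ⟦ a , y ⟧                                    ∎

  conj-central : ∀ a Z y → N Z → (a ∙ (Z ∙ y)) ∙ a ⁻¹ ≈ (Z ∙ ⟦ a , y ⟧) ∙ y
  conj-central a Z y Z∈N = begin
    (a ∙ (Z ∙ y)) ∙ a ⁻¹         ≈⟨ solve monoid ⟩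
    ((a ∙ Z) ∙ y) ∙ a ⁻¹         ≈⟨ ∙-congʳ (∙-congʳ (N-central Z∈N a)) ⟨
    ((Z ∙ a) ∙ y) ∙ a ⁻¹         ≈⟨ solve monoid ⟩
    Z ∙ ((a ∙ y) ∙ a ⁻¹)         ≈⟨ ∙-congˡ (conj-by a y) ⟩
    Z ∙ (y ∙ ⟦ a , y ⟧)          ≈⟨ ∙-congˡ (N-central (N-comm a y) y) ⟨
    Z ∙ (⟦ a , y ⟧ ∙ y)          ≈⟨ solve monoid ⟩
    (Z ∙ ⟦ a , y ⟧) ∙ y          ∎

  -- The voltage of a detour: replacing a step y of a walk (voltage pA y pB)
  -- by a, a walk of voltage Z y, a⁻¹ multiplies the voltage by Z [a, y].
  detour-voltage : ∀ a pA pB Z y → N Z →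
                   pA ∙ (a ∙ ((Z ∙ y) ∙ (a ⁻¹ ∙ pB))) ≈ (Z ∙ ⟦ a , y ⟧) ∙ (pA ∙ (y ∙ pB))
  detour-voltage a pA pB Z y Z∈N = begin
    pA ∙ (a ∙ ((Z ∙ y) ∙ (a ⁻¹ ∙ pB)))    ≈⟨ solve monoid ⟩
    pA ∙ (((a ∙ (Z ∙ y)) ∙ a ⁻¹) ∙ pB)    ≈⟨ ∙-congˡ (∙-congʳ (conj-central a Z y Z∈N)) ⟩
    pA ∙ (((Z ∙ ⟦ a , y ⟧) ∙ y) ∙ pB)     ≈⟨ solve monoid ⟩
    (pA ∙ (Z ∙ ⟦ a , y ⟧)) ∙ (y ∙ pB)     ≈⟨ ∙-congʳ (N-central (N-∙ Z∈N (N-comm a y)) pA) ⟨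
    ((Z ∙ ⟦ a , y ⟧) ∙ pA) ∙ (y ∙ pB)     ≈⟨ assoc _ _ _ ⟩
    (Z ∙ ⟦ a , y ⟧) ∙ (pA ∙ (y ∙ pB))     ∎

  Π-drop-last : ∀ A e v y → Π (A ++ [ e ]) ≈ v → e ≈ y ⁻¹ → Π A ≈ v ∙ y
  Π-drop-last A e v y ΠAe≈v e≈ = begin
    Π A                    ≈⟨ [y∙x]∙x⁻¹≈y e (Π A) ⟨
    (Π A ∙ e) ∙ e ⁻¹       ≈⟨ ∙-cong (trans (∙-congˡ (sym (identityʳ e))) (trans (sym (Π-++ A [ e ])) ΠAe≈v))
                                     (trans (⁻¹-cong e≈) (⁻¹-involutive y)) ⟩
    v ∙ y                  ∎

  central-shuffle : ∀ {X Y z p} → N X → N Y → N z → N p → ((X ∙ Y) ∙ z) ∙ p ≈ (p ∙ X) ∙ (z ∙ Y)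
  central-shuffle {X} {Y} {z} {p} X∈N Y∈N z∈N p∈N = begin
    ((X ∙ Y) ∙ z) ∙ p     ≈⟨ N-central p∈N _ ⟨
    p ∙ ((X ∙ Y) ∙ z)     ≈⟨ ∙-congˡ (assoc _ _ _) ⟩
    p ∙ (X ∙ (Y ∙ z))     ≈⟨ ∙-congˡ (∙-congˡ (N-central Y∈N z)) ⟩
    p ∙ (X ∙ (z ∙ Y))     ≈⟨ assoc _ _ _ ⟨
    (p ∙ X) ∙ (z ∙ Y)     ∎

  prodFrom : (ℕ → Carrier) → ℕ → ℕ → Carrier
  prodFrom f i zero    = ε
  prodFrom f i (suc n) = f i ∙ prodFrom f (suc i) n

  prodFrom-∷ʳ : ∀ f i n → prodFrom f i (suc n) ≈ prodFrom f i n ∙ f (i + n)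
  prodFrom-∷ʳ f i zero    = trans (identityʳ _) (trans (sym (identityˡ _)) (∙-congˡ (reflexive (≡.cong f (≡.sym (+-identityʳ i))))))
  prodFrom-∷ʳ f i (suc n) = begin
    f i ∙ prodFrom f (suc i) (suc n)               ≈⟨ ∙-congˡ (prodFrom-∷ʳ f (suc i) n) ⟩
    f i ∙ (prodFrom f (suc i) n ∙ f (suc i + n))   ≈⟨ assoc _ _ _ ⟨
    (f i ∙ prodFrom f (suc i) n) ∙ f (suc i + n)   ≈⟨ ∙-congˡ (reflexive (≡.cong f (≡.sym (+-suc i n)))) ⟩
    (f i ∙ prodFrom f (suc i) n) ∙ f (i + suc n)   ∎

  prod≈prodFrom : ∀ f n → prod n f ≈ prodFrom f 0 n
  prod≈prodFrom f zero    = refl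
  prod≈prodFrom f (suc n) = trans (∙-congʳ (prod≈prodFrom f n)) (sym (prodFrom-∷ʳ f 0 n))

  prodFrom-N : ∀ f i n → (∀ j → j < i + n → N (f j)) → N (prodFrom f i n)
  prodFrom-N f i zero    _   = N-ε
  prodFrom-N f i (suc n) f∈N =
    N-∙ (f∈N i (≡.subst (i <_) (≡.sym (+-suc i n)) (s≤s (m≤m+n i n))))
        (prodFrom-N f (suc i) n (λ j lt → f∈N j (≡.subst (j <_) (≡.sym (+-suc i n)) lt)))

  toHamCycle : ∀ {k v} (F : List Carrier) → All (Step k) F → Distinct (vertices ε F) →
               (∀ {h} → Gk k h → Visits h (vertices ε F)) → N (Π F) →
               (∀ j → j < k → TwoSites (_≈ σ j) (_≈ σ j ⁻¹) ε F) → Π F ≈ v →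
               Σ (HamCycle k) λ C → HamCycle.Covers C × HamCycle.voltage C ≈ v
  toHamCycle {k} F valid distinct onto closed covers ΠF≈v =
    record { n = n ; start = ε ; start∈ = gen-ε ; step = step
           ; step∈ = ListFacts.at-All ε valid
           ; distinct = distinct' ; onto = onto' ; closes = closes } ,
    (λ j j<k → let sites p q p< q< p≢q e₁ e₂ = covers j j<k in p , q , p< , q< , p≢q , e₁ , e₂) ,
    trans prod≈ΠF ΠF≈v
    where
      n : ℕ
      n = length F
      step : ℕ → Carrier
      step = at ε F
      V : ℕ → Carrier
      V j = end ε (applyUpTo step j)
      V≈ : ∀ j → V j ≈ ε ∙ prod j step
      V≈ j = end-applyUpTo ε step j
      vertices≡ : vertices ε F ≡ applyUpTo V n
      vertices≡ = ≡.trans (≡.cong (vertices ε) (ListFacts.applyUpTo-at ε F)) (vertices-applyUpTo ε step n)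
      separated : ∀ {i j} → i < j → j < n → V i ≁ V j
      separated = ListFacts.AllPairs-applyUpTo⁻ V n (≡.subst Distinct vertices≡ distinct)
      distinct' : ∀ i j → i < n → j < n → (ε ∙ prod i step) ~ (ε ∙ prod j step) → i ≡ j
      distinct' i j i<n j<n e with <-cmp i j
      ... | tri< i<j _ _ = ⊥-elim (separated i<j j<n (~-resp (sym (V≈ i)) (sym (V≈ j)) e))
      ... | tri≈ _ i≡j _ = i≡j
      ... | tri> _ _ j<i = ⊥-elim (separated j<i i<n (~-resp (sym (V≈ j)) (sym (V≈ i)) (~-sym e)))
      onto' : ∀ {h} → Gk k h → Σ ℕ λ j → j < n × (ε ∙ prod j step) ~ h
      onto' h∈ with j , j<n , e ← AnyP.applyUpTo⁻ V (≡.subst (Visits _) vertices≡ (onto h∈)) =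
        j , j<n , ~-trans (≈⇒~ (sym (V≈ j))) e
      prod≈ΠF : prod n step ≈ Π F
      prod≈ΠF = trans (sym (Π-applyUpTo step n)) (reflexive (≡.cong Π (≡.sym (ListFacts.applyUpTo-at ε F))))
      closes : (ε ∙ prod n step) ~ ε
      closes = N⇒~ε (N-resp (trans (sym prod≈ΠF) (sym (identityˡ _))) closed)

  module Cosets (k : ℕ) where

    a : Carrier
    a = σ k

    record InCoset (i : ℕ) (u : Carrier) : Set (c ⊔ ℓ) where
      constructor coset
      field offset : Gk k (powℕ a i ⁻¹ ∙ u)
    open InCoset public

    InCoset-≈ : ∀ {i u v} → u ≈ v → InCoset i u → InCoset i v
    InCoset-≈ e (coset p) = coset (gen-≈ (∙-congˡ e) p)

    InCoset-~ : ∀ {i u v} → InCoset i u → u ~ v → InCoset i v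
    InCoset-~ {i} {u} {v} (coset p) n =
      coset (gen-≈ (trans (assoc _ _ _) (∙-congˡ (x∙[x⁻¹∙y]≈y u v))) (gen-∙ p (N⊆Gk k n)))

    InCoset-step : ∀ {i u t} → InCoset i u → Gk k t → InCoset i (u ∙ t)
    InCoset-step (coset p) q = coset (gen-≈ (assoc _ _ _) (gen-∙ p q))

    InCoset₀ : ∀ {u} → Gk k u → InCoset 0 u
    InCoset₀ p = coset (gen-≈ (sym (trans (∙-congʳ ε⁻¹≈ε) (identityˡ _))) p)

    InCoset₀⁻ : ∀ {u} → InCoset 0 u → Gk k u
    InCoset₀⁻ (coset p) = gen-≈ (trans (∙-congʳ ε⁻¹≈ε) (identityˡ _)) p

    Gk-diff : ∀ {t x y} → Gk k (t ⁻¹ ∙ x) → Gk k (t ⁻¹ ∙ y) → Gk k (x ⁻¹ ∙ y)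
    Gk-diff {t} {x} {y} p q = gen-≈ (begin
      (t ⁻¹ ∙ x) ⁻¹ ∙ (t ⁻¹ ∙ y)           ≈⟨ ∙-congʳ (⁻¹-anti-homo-∙ _ _) ⟩
      (x ⁻¹ ∙ t ⁻¹ ⁻¹) ∙ (t ⁻¹ ∙ y)        ≈⟨ solve monoid ⟩
      x ⁻¹ ∙ (t ⁻¹ ⁻¹ ∙ (t ⁻¹ ∙ y))        ≈⟨ ∙-congˡ (x⁻¹∙[x∙y]≈y _ y) ⟩
      x ⁻¹ ∙ y                             ∎) (gen-∙ (gen-⁻¹ p) q)

    InCoset-diff : ∀ {i u v} → InCoset i u → InCoset i v → Gk k (u ⁻¹ ∙ v)
    InCoset-diff (coset p) (coset q) = Gk-diff p q

    -- aⁱ G_k · aʲ G_k = a^{i+j} G_k  (G_k is normal)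
    InCoset-∙ : ∀ {i j u v} → InCoset i u → InCoset j v → InCoset (i + j) (u ∙ v)
    InCoset-∙ {i} {j} {u} {v} (coset p) (coset q) =
      coset (gen-≈ eq (gen-∙ (Gk-conj k (powℕ a j) p) q))
      where
        A B : Carrier
        A = powℕ a i ; B = powℕ a j
        eq : ((B ⁻¹ ∙ (A ⁻¹ ∙ u)) ∙ B) ∙ (B ⁻¹ ∙ v) ≈ powℕ a (i + j) ⁻¹ ∙ (u ∙ v)
        eq = begin
          ((B ⁻¹ ∙ (A ⁻¹ ∙ u)) ∙ B) ∙ (B ⁻¹ ∙ v)  ≈⟨ solve monoid ⟩
          (B ⁻¹ ∙ (A ⁻¹ ∙ u)) ∙ (B ∙ (B ⁻¹ ∙ v))  ≈⟨ ∙-congˡ (x∙[x⁻¹∙y]≈y B v) ⟩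
          (B ⁻¹ ∙ (A ⁻¹ ∙ u)) ∙ v                 ≈⟨ solve monoid ⟩
          (B ⁻¹ ∙ A ⁻¹) ∙ (u ∙ v)                 ≈⟨ ∙-congʳ (⁻¹-anti-homo-∙ A B) ⟨
          (A ∙ B) ⁻¹ ∙ (u ∙ v)                    ≈⟨ ∙-congʳ (⁻¹-cong (powℕ-+ a i j)) ⟨
          powℕ a (i + j) ⁻¹ ∙ (u ∙ v)             ∎

    InCoset-reduce : ∀ {d e u} → Gk k (powℕ a d) → InCoset (d + e) u → InCoset e u
    InCoset-reduce {d} {e} {u} pd (coset p) = coset (gen-≈ eq (gen-∙ (Gk-conj k (powℕ a e) pd) p))
      where
        D E : Carrier
        D = powℕ a d ; E = powℕ a e
        eq : ((E ⁻¹ ∙ D) ∙ E) ∙ (powℕ a (d + e) ⁻¹ ∙ u) ≈ E ⁻¹ ∙ u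
        eq = begin
          ((E ⁻¹ ∙ D) ∙ E) ∙ (powℕ a (d + e) ⁻¹ ∙ u)
            ≈⟨ ∙-congˡ (∙-congʳ (trans (⁻¹-cong (powℕ-+ a d e)) (⁻¹-anti-homo-∙ D E))) ⟩
          ((E ⁻¹ ∙ D) ∙ E) ∙ ((E ⁻¹ ∙ D ⁻¹) ∙ u)   ≈⟨ solve monoid ⟩
          (E ⁻¹ ∙ D) ∙ (E ∙ (E ⁻¹ ∙ (D ⁻¹ ∙ u)))   ≈⟨ ∙-congˡ (x∙[x⁻¹∙y]≈y E _) ⟩
          (E ⁻¹ ∙ D) ∙ (D ⁻¹ ∙ u)                  ≈⟨ assoc _ _ _ ⟩
          E ⁻¹ ∙ (D ∙ (D ⁻¹ ∙ u))                  ≈⟨ ∙-congˡ (x∙[x⁻¹∙y]≈y D u) ⟩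
          E ⁻¹ ∙ u                                 ∎

    InCoset-⁻¹ : ∀ {e f u} → Gk k (powℕ a (f + e)) → InCoset e u → InCoset f (u ⁻¹)
    InCoset-⁻¹ {e} {f} {u} pd (coset p) =
      coset (gen-≈ eq (Gk-conj k (powℕ a f) (gen-∙ (gen-⁻¹ p) (gen-⁻¹ pd))))
      where
        E F : Carrier
        E = powℕ a e ; F = powℕ a f
        eq : (F ⁻¹ ∙ ((E ⁻¹ ∙ u) ⁻¹ ∙ powℕ a (f + e) ⁻¹)) ∙ F ≈ F ⁻¹ ∙ u ⁻¹
        eq = begin
          (F ⁻¹ ∙ ((E ⁻¹ ∙ u) ⁻¹ ∙ powℕ a (f + e) ⁻¹)) ∙ F
            ≈⟨ ∙-congʳ (∙-congˡ (∙-cong (⁻¹-anti-homo-∙ _ _)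
                 (trans (⁻¹-cong (powℕ-+ a f e)) (⁻¹-anti-homo-∙ F E)))) ⟩
          (F ⁻¹ ∙ ((u ⁻¹ ∙ E ⁻¹ ⁻¹) ∙ (E ⁻¹ ∙ F ⁻¹))) ∙ F   ≈⟨ solve monoid ⟩
          (F ⁻¹ ∙ u ⁻¹) ∙ ((E ⁻¹ ⁻¹ ∙ (E ⁻¹ ∙ F ⁻¹)) ∙ F)  ≈⟨ ∙-congˡ (∙-congʳ (x⁻¹∙[x∙y]≈y _ _)) ⟩
          (F ⁻¹ ∙ u ⁻¹) ∙ (F ⁻¹ ∙ F)                      ≈⟨ ∙-congˡ (inverseˡ F) ⟩
          (F ⁻¹ ∙ u ⁻¹) ∙ ε                               ≈⟨ identityʳ _ ⟩
          F ⁻¹ ∙ u ⁻¹                                     ∎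

    InCoset-a : ∀ {i u} → InCoset i u → InCoset (suc i) (u ∙ a)
    InCoset-a {i} {u} (coset p) = coset (gen-≈ (begin
      (a ⁻¹ ∙ (powℕ a i ⁻¹ ∙ u)) ∙ a   ≈⟨ solve monoid ⟩
      (a ⁻¹ ∙ powℕ a i ⁻¹) ∙ (u ∙ a)   ≈⟨ ∙-congʳ (⁻¹-anti-homo-∙ _ _) ⟨
      (powℕ a i ∙ a) ⁻¹ ∙ (u ∙ a)      ∎) (Gk-conj k a p))

    end-Gk : ∀ {g} ts → Gk k g → All (Gk k) ts → Gk k (end g ts)
    end-Gk []       p []       = p
    end-Gk (t ∷ ts) p (q ∷ qs) = end-Gk ts (gen-∙ p q) qs

    end-InCoset : ∀ {i g} ts → InCoset i g → All (Gk k) ts → InCoset i (end g ts)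
    end-InCoset []       p []       = p
    end-InCoset (t ∷ ts) p (q ∷ qs) = end-InCoset ts (InCoset-step p q) qs

    vertices-InCoset : ∀ {i g} ts → InCoset i g → All (Gk k) ts → All (InCoset i) (vertices g ts)
    vertices-InCoset []       p []       = []
    vertices-InCoset (t ∷ ts) p (q ∷ qs) = p ∷ vertices-InCoset ts (InCoset-step p q) qs

    path-InCoset : ∀ {i g} ts → InCoset i g → All (Gk k) ts → All (InCoset i) (path g ts)
    path-InCoset ts p qs = AllP.++⁺ (vertices-InCoset ts p qs) (end-InCoset ts p qs ∷ [])

    a^i∈Gk+1 : ∀ i → Gk (suc k) (powℕ a i)
    a^i∈Gk+1 zero    = gen-ε
    a^i∈Gk+1 (suc i) = gen-∙ (a^i∈Gk+1 i) (σ∈Gk (n<1+n k))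

    coset-below : ∀ d → 0 < d → Gk k (powℕ a d) → ∀ {h} → Gk (suc k) h → Σ ℕ λ e → e < d × InCoset e h
    coset-below d 0<d pd (gen (inj₁ (Level.lift (j , j<1+k , h≈σj)))) with m<1+n⇒m<n∨m≡n j<1+k
    ... | inj₁ j<k = 0 , 0<d , InCoset₀ (gen-≈ (sym h≈σj) (σ∈Gk j<k))
    coset-below (suc zero) 0<d pd (gen (inj₁ (Level.lift (j , j<1+k , h≈a)))) | inj₂ ≡.refl =
      0 , 0<d , InCoset₀ (gen-≈ (trans (identityˡ _) (sym h≈a)) pd)
    coset-below (suc (suc d)) 0<d pd (gen (inj₁ (Level.lift (j , j<1+k , h≈a)))) | inj₂ ≡.refl =
      1 , s≤s (s≤s z≤n) ,
      coset (gen-≈ (trans (sym (inverseˡ a)) (∙-cong (⁻¹-cong (sym (identityˡ a))) (sym h≈a))) gen-ε)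
    coset-below d 0<d pd (gen (inj₂ n)) = 0 , 0<d , InCoset₀ (N⊆Gk k n)
    coset-below d 0<d pd gen-ε = 0 , 0<d , InCoset₀ gen-ε
    coset-below d 0<d pd (gen-∙ {x} {y} p q)
      with e₁ , e₁<d , c₁ ← coset-below d 0<d pd p | e₂ , e₂<d , c₂ ← coset-below d 0<d pd q
      with e₁ + e₂ <? d
    ... | yes e₁+e₂<d = e₁ + e₂ , e₁+e₂<d , InCoset-∙ c₁ c₂
    ... | no ¬e₁+e₂<d =
      (e₁ + e₂) ∸ d , reduced<d ,
      InCoset-reduce pd (≡.subst (λ z → InCoset z (x ∙ y)) (≡.sym d+rest) (InCoset-∙ c₁ c₂))
      where
        d+rest : d + ((e₁ + e₂) ∸ d) ≡ e₁ + e₂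
        d+rest = m+[n∸m]≡n (≮⇒≥ ¬e₁+e₂<d)
        reduced<d : (e₁ + e₂) ∸ d < d
        reduced<d = +-cancelˡ-< d _ d (≡.subst (_< d + d) (≡.sym d+rest) (+-mono-< e₁<d e₂<d))
    coset-below d 0<d pd (gen-⁻¹ p) with coset-below d 0<d pd p
    ... | zero  , _   , c = 0 , 0<d , InCoset₀ (gen-⁻¹ (InCoset₀⁻ c))
    ... | suc e , e<d , c =
      d ∸ suc e , ∸-monoʳ-< {d} {suc e} {0} (s≤s z≤n) (<⇒≤ e<d) ,
      InCoset-⁻¹ (≡.subst (λ z → Gk k (powℕ a z)) (≡.sym (m∸n+n≡m (<⇒≤ e<d))) pd) c
    coset-below d 0<d pd (gen-≈ e p) with e' , e'<d , c ← coset-below d 0<d pd p = e' , e'<d , InCoset-≈ e c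

    -- With |Ḡ_{k+1} : Ḡ_k| = m, the cosets a⁰G_k, …, a^{m-1}G_k are exactly
    -- the cosets of G_k in G_{k+1}, each once (i.e. a has order m mod G_k).
    module Index (m : ℕ) (idx : IsIndex (Gk (suc k)) (Gk k) m) where

      private
        rep : ℕ → Carrier
        rep = proj₁ idx
        rep∈ : ∀ j → j < m → Gk (suc k) (rep j)
        rep∈ = proj₁ (proj₂ idx)
        rep-cover : ∀ {h} → Gk (suc k) h → Σ ℕ λ j → j < m × Gk k (rep j ⁻¹ ∙ h)
        rep-cover = proj₁ (proj₂ (proj₂ idx))
        rep-unique : ∀ {h} j j' → j < m → j' < m → Gk k (rep j ⁻¹ ∙ h) → Gk k (rep j' ⁻¹ ∙ h) → j ≡ j'
        rep-unique = proj₂ (proj₂ (proj₂ idx))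

        power-gap : ∀ {i j} → i < j → Gk k (powℕ a i ⁻¹ ∙ powℕ a j) → Gk k (powℕ a (j ∸ i))
        power-gap {i} i<j p =
          gen-≈ (powℕ-diff a i _) (≡.subst (λ z → Gk k (powℕ a i ⁻¹ ∙ powℕ a z)) (≡.sym (m+[n∸m]≡n (<⇒≤ i<j))) p)

        positive-gap : ∀ {i j} → i < j → 0 < j ∸ i
        positive-gap {i} {j} i<j = ≡.subst (_< j ∸ i) (n∸n≡0 i) (∸-monoˡ-< {i} {i} {j} i<j ≤-refl)

      private
        cosetOfPower : Fin (suc m) → Fin m
        cosetOfPower i = fromℕ< (proj₁ (proj₂ (rep-cover (a^i∈Gk+1 (toℕ i)))))

        cosetBelow : ∀ d → 0 < d → Gk k (powℕ a d) → ∀ n → n < m → Σ ℕ λ e → e < d × InCoset e (rep n)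
        cosetBelow d 0<d pd n n<m = coset-below d 0<d pd (rep∈ n n<m)

      -- Pigeonhole on a⁰, …, a^m among m cosets: some 0 < d ≤ m has a^d ∈ G_k.
      power-in-Gk : Σ ℕ λ d → 0 < d × d ≤ m × Gk k (powℕ a d)
      power-in-Gk with i , j , i<j , same ← pigeonhole (n<1+n m) cosetOfPower =
        J ∸ I , positive-gap i<j , ≤-trans (m∸n≤m J I) (≤-pred (toℕ<n j)) ,
        power-gap i<j (Gk-diff (rep-of I) (≡.subst (λ z → Gk k (rep z ⁻¹ ∙ powℕ a J)) (≡.sym same') (rep-of J)))
        where
          I J : ℕ
          I = toℕ i ; J = toℕ j
          rep-of : ∀ n → Gk k (rep (proj₁ (rep-cover (a^i∈Gk+1 n))) ⁻¹ ∙ powℕ a n)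
          rep-of n = proj₂ (proj₂ (rep-cover (a^i∈Gk+1 n)))
          same' : proj₁ (rep-cover (a^i∈Gk+1 I)) ≡ proj₁ (rep-cover (a^i∈Gk+1 J))
          same' = ≡.trans (≡.sym (toℕ-fromℕ< _)) (≡.trans (≡.cong toℕ same) (toℕ-fromℕ< _))

      -- Pigeonhole on the m representatives among d < m cosets aᵉG_k:
      -- no 0 < d < m has a^d ∈ G_k.
      no-smaller-power : ∀ d → 0 < d → d < m → ¬ Gk k (powℕ a d)
      no-smaller-power d 0<d d<m pd
        with j , j' , j<j' , same ← pigeonhole d<m (λ j → fromℕ< (proj₁ (proj₂ (cosetBelow d 0<d pd (toℕ j) (toℕ<n j))))) =
        <⇒≢ j<j' (rep-unique J J' (toℕ<n j) (toℕ<n j') (gen-≈ (sym (inverseˡ _)) gen-ε)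
          (InCoset-diff (≡.subst (λ z → InCoset z (rep J')) (≡.sym same') (in-coset J' (toℕ<n j'))) (in-coset J (toℕ<n j))))
        where
          below : ∀ n → n < m → Σ ℕ λ e → e < d × InCoset e (rep n)
          below = cosetBelow d 0<d pd
          J J' : ℕ
          J = toℕ j ; J' = toℕ j'
          in-coset : ∀ n → (n<m : n < m) → InCoset (proj₁ (below n n<m)) (rep n)
          in-coset n n<m = proj₂ (proj₂ (below n n<m))
          same' : proj₁ (below J (toℕ<n j)) ≡ proj₁ (below J' (toℕ<n j'))
          same' = ≡.trans (≡.sym (toℕ-fromℕ< _)) (≡.trans (≡.cong toℕ same) (toℕ-fromℕ< _))

      coset-cover : ∀ {h} → Gk (suc k) h → Σ ℕ λ e → e < m × InCoset e h
      coset-cover h∈ with d , 0<d , d≤m , pd ← power-in-Gk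
        with e , e<d , c ← coset-below d 0<d pd h∈ = e , <-≤-trans e<d d≤m , c

      coset-disjoint : ∀ {i i' u v} → InCoset i u → InCoset i' v → i < i' → i' < m → u ≁ v
      coset-disjoint {i} {i'} {u} {v} cu cv i<i' i'<m u~v =
        no-smaller-power (i' ∸ i) (positive-gap i<i') (≤-<-trans (m∸n≤m i' i) i'<m)
          (power-gap i<i' (gen-≈ eq (gen-∙ (offset (InCoset-~ cu u~v)) (gen-⁻¹ (offset cv)))))
        where eq : (powℕ a i ⁻¹ ∙ v) ∙ (powℕ a i' ⁻¹ ∙ v) ⁻¹ ≈ powℕ a i ⁻¹ ∙ powℕ a i'
              eq = begin
                (powℕ a i ⁻¹ ∙ v) ∙ (powℕ a i' ⁻¹ ∙ v) ⁻¹       ≈⟨ ∙-congˡ (⁻¹-anti-homo-∙ _ _) ⟩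
                (powℕ a i ⁻¹ ∙ v) ∙ (v ⁻¹ ∙ powℕ a i' ⁻¹ ⁻¹)    ≈⟨ solve monoid ⟩
                powℕ a i ⁻¹ ∙ (v ∙ (v ⁻¹ ∙ powℕ a i' ⁻¹ ⁻¹))    ≈⟨ ∙-congˡ (x∙[x⁻¹∙y]≈y v _) ⟩
                powℕ a i ⁻¹ ∙ powℕ a i' ⁻¹ ⁻¹                   ≈⟨ ∙-congˡ (⁻¹-involutive _) ⟩
                powℕ a i ⁻¹ ∙ powℕ a i'                         ∎

    record CycleList (v : Carrier) : Set (c ⊔ ℓ) where
      field
        start    : Carrier
        start∈   : Gk k start
        steps    : List Carrier
        valid    : All (Step k) steps
        distinct : Distinct (vertices start steps)
        onto     : ∀ {h} → Gk k h → Visits h (vertices start steps)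
        voltage  : Π steps ≈ v
        closed   : N (Π steps)
        covers   : ∀ j → j < k → TwoSites (_≈ σ j) (_≈ σ j ⁻¹) ε steps

    fromHamCycle : ∀ {v} → 𝒱 k v → CycleList v
    fromHamCycle {v} (C , covers , volt) = record
      { start = start ; start∈ = start∈ ; steps = applyUpTo step n
      ; valid = AllP.applyUpTo⁺₁ step n (λ {i} → step∈ i)
      ; distinct = ≡.subst Distinct (≡.sym vertices≡)
          (AllPairsP.applyUpTo⁺₁ V n (λ {i} {j} i<j j<n e →
             <⇒≢ i<j (HamCycle.distinct C i j (<-trans i<j j<n) j<n
                        (~-resp (end-applyUpTo start step i) (end-applyUpTo start step j) e))))
      ; onto = λ h∈ → let j , j<n , e = HamCycle.onto C h∈ in
          ≡.subst (Visits _) (≡.sym vertices≡)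
            (AnyP.applyUpTo⁺ V (~-trans (≈⇒~ (end-applyUpTo start step j)) e) j<n)
      ; voltage = trans (Π-applyUpTo step n) volt
      ; closed = N-resp (sym (Π-applyUpTo step n)) (N-resp returns (N-⁻¹ closes))
      ; covers = λ j j<k → let p , q , p<n , q<n , p≢q , e₁ , e₂ = covers j j<k in
          sites p q (≡.subst (p <_) (≡.sym (length-applyUpTo step n)) p<n)
                    (≡.subst (q <_) (≡.sym (length-applyUpTo step n)) q<n) p≢q
                    (trans (reflexive (at-applyUpTo ε step n p p<n)) e₁)
                    (trans (reflexive (at-applyUpTo ε step n q q<n)) e₂)
      }
      where
        open HamCycle C
        V : ℕ → Carrier
        V j = end start (applyUpTo step j)
        vertices≡ : vertices start (applyUpTo step n) ≡ applyUpTo V n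
        vertices≡ = vertices-applyUpTo start step n
        returns : ((start ∙ prod n step) ⁻¹ ∙ start) ⁻¹ ≈ prod n step
        returns = begin
          ((start ∙ prod n step) ⁻¹ ∙ start) ⁻¹           ≈⟨ ⁻¹-cong (∙-congʳ (⁻¹-anti-homo-∙ _ _)) ⟩
          ((prod n step ⁻¹ ∙ start ⁻¹) ∙ start) ⁻¹        ≈⟨ ⁻¹-cong ([y∙x⁻¹]∙x≈y start _) ⟩
          prod n step ⁻¹ ⁻¹                               ≈⟨ ⁻¹-involutive _ ⟩
          prod n step                                     ∎

    sitesOf : ∀ {v} (C : CycleList v) y → Step k y → TwoSites (_≈ y) (_≈ y ⁻¹) ε (CycleList.steps C)
    sitesOf C y (j , j<k , y≈σj) with sites p q p< q< p≢q e₁ e₂ ← CycleList.covers C j j<k | y≈σj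
    ... | inj₁ y≈ = sites p q p< q< p≢q (trans e₁ (sym y≈)) (trans e₂ (⁻¹-cong (sym y≈)))
    ... | inj₂ y≈ = sites q p q< p< (λ e → p≢q (≡.sym e)) (trans e₂ (sym y≈))
                          (trans e₁ (trans (sym (⁻¹-involutive _)) (⁻¹-cong (sym y≈))))

    record Tour (i : ℕ) (w v : Carrier) (steps : List Carrier) : Set (c ⊔ ℓ) where
      field
        valid    : All (Step k) steps
        distinct : Distinct (vertices w steps)
        onto     : ∀ {h} → InCoset i h → Visits h (vertices w steps)
        voltage  : Π steps ≈ v

    Tour-≡ : ∀ {i w v ts ts'} → ts ≡ ts' → Tour i w v ts → Tour i w v ts'
    Tour-≡ ≡.refl T = T

    Π-rotate : ∀ X Y → N (Π (X ++ Y)) → Π (Y ++ X) ≈ Π (X ++ Y)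
    Π-rotate X Y n = begin
      Π (Y ++ X)                          ≈⟨ Π-++ Y X ⟩
      Π Y ∙ Π X                           ≈⟨ ∙-congʳ (x⁻¹∙[x∙y]≈y (Π X) (Π Y)) ⟨
      (Π X ⁻¹ ∙ (Π X ∙ Π Y)) ∙ Π X        ≈⟨ assoc _ _ _ ⟩
      Π X ⁻¹ ∙ ((Π X ∙ Π Y) ∙ Π X)        ≈⟨ ∙-congˡ (N-central (N-resp (Π-++ X Y) n) (Π X)) ⟩
      Π X ⁻¹ ∙ (Π X ∙ (Π X ∙ Π Y))        ≈⟨ x⁻¹∙[x∙y]≈y _ _ ⟩
      Π X ∙ Π Y                           ≈⟨ Π-++ X Y ⟨
      Π (X ++ Y)                          ∎

    module Rotate {v} (C : CycleList v) {X Y : List Carrier} (split : CycleList.steps C ≡ X ++ Y)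
                  {i : ℕ} {w : Carrier} (w∈ : InCoset i w) where
      open CycleList C using (start; start∈)

      private
        valid : All (Step k) (X ++ Y)
        valid = ≡.subst (All (Step k)) split (CycleList.valid C)
        closed : N (Π X ∙ Π Y)
        closed = N-resp (trans (reflexive (≡.cong Π split)) (Π-++ X Y)) (CycleList.closed C)
        E : Carrier
        E = end start X
        -- the translation carrying the old walk to the new one
        τ : Carrier
        τ = w ∙ E ⁻¹

        -- after Y the new walk is at τ start, where the old walk began
        returns : end w Y ~ (τ ∙ start)
        returns = ~-resp (sym (end≈ w Y)) eq (∙-~ˡ w (N-resp (⁻¹-anti-homo-∙ (Π X) (Π Y)) (N-⁻¹ closed)))
          where eq : w ∙ Π X ⁻¹ ≈ τ ∙ start
                eq = begin
                  w ∙ Π X ⁻¹                        ≈⟨ ∙-congˡ ([y∙x⁻¹]∙x≈y start (Π X ⁻¹)) ⟨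
                  w ∙ ((Π X ⁻¹ ∙ start ⁻¹) ∙ start) ≈⟨ ∙-congˡ (∙-congʳ (⁻¹-anti-homo-∙ start (Π X))) ⟨
                  w ∙ ((start ∙ Π X) ⁻¹ ∙ start)    ≈⟨ ∙-congˡ (∙-congʳ (⁻¹-cong (end≈ start X))) ⟨
                  w ∙ (E ⁻¹ ∙ start)                ≈⟨ assoc _ _ _ ⟨
                  τ ∙ start                         ∎

        translated : vertices w (Y ++ X) ~ᴸ List.map (τ ∙_) (vertices E Y ++ vertices start X)
        translated rewrite vertices-++ w Y X | map-++ (τ ∙_) (vertices E Y) (vertices start X) =
          PW.++⁺ (~ᴸ-trans (vertices-~ Y (≈⇒~ (sym ([y∙x⁻¹]∙x≈y E w)))) (vertices-translate τ E Y))
                 (~ᴸ-trans (vertices-~ X returns) (vertices-translate τ start X))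

        old-vertices : vertices start (X ++ Y) ≡ vertices start X ++ vertices E Y
        old-vertices = vertices-++ start X Y

      valid-rotated : All (Step k) (Y ++ X)
      valid-rotated = AllP.++⁺ (AllP.++⁻ʳ X valid) (AllP.++⁻ˡ X valid)

      tour : Tour i w v (Y ++ X)
      tour = record
        { valid = valid-rotated
        ; distinct = Distinct-~ᴸ
            (AllPairsP.map⁺ (AllPairs.map (λ n e → n (∙-~ˡ⁻ τ e))
              (AllPairs-rotate (vertices start X)
                (≡.subst Distinct (≡.trans (≡.cong (vertices start) split) old-vertices)
                   (CycleList.distinct C)))))
            (~ᴸ-sym translated)
        ; onto = onto
        ; voltage = trans (Π-rotate X Y (N-resp (reflexive (≡.cong Π split)) (CycleList.closed C)))
                     (trans (reflexive (≡.cong Π (≡.sym split))) (CycleList.voltage C))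
        }
        where
          onto : ∀ {h} → InCoset i h → Visits h (vertices w (Y ++ X))
          onto {h} h∈ = Visits-~ᴸ (AnyP.map⁺ (Any.map (λ e → ~-resp refl (x∙[x⁻¹∙y]≈y τ h) (∙-~ˡ τ e))
                                     (AnyP.++-comm (vertices start X) (vertices E Y) old-visit)))
                                  (~ᴸ-sym translated)
            where
              g∈ : Gk k (τ ⁻¹ ∙ h)
              g∈ = gen-≈ (begin
                E ∙ (w ⁻¹ ∙ h)            ≈⟨ solve monoid ⟩
                (E ∙ w ⁻¹) ∙ h            ≈⟨ ∙-congʳ (∙-congʳ (⁻¹-involutive E)) ⟨
                (E ⁻¹ ⁻¹ ∙ w ⁻¹) ∙ h      ≈⟨ ∙-congʳ (⁻¹-anti-homo-∙ w (E ⁻¹)) ⟨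
                τ ⁻¹ ∙ h                  ∎)
                (gen-∙ (end-Gk X start∈ (All.map Step⇒Gk (AllP.++⁻ˡ X valid))) (InCoset-diff w∈ h∈))
              old-visit : Visits (τ ⁻¹ ∙ h) (vertices start X ++ vertices E Y)
              old-visit = ≡.subst (Visits _) (≡.trans (≡.cong (vertices start) split) old-vertices)
                                  (CycleList.onto C g∈)

    -- The construction, for cycles π_0, …, π_{m-1} ∈ 𝒱_k and steps x_i = s*_i.  Coherence of the x_i (x_{i+1} = x_i⁻¹ only
    -- if x_{i+1} = x_i) makes the two steps removed from a middle cycle distinct.
    module Construction (m : ℕ) (idx : IsIndex (Gk (suc k)) (Gk k) m) (2≤m : 2 ≤ m)
                        (π : ℕ → Carrier) (π∈𝒱 : ∀ i → i < m → 𝒱 k (π i))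
                        (x : ℕ → Carrier) (x-step : ∀ i → i < m ∸ 1 → Step k (x i))
                        (x-coherent : ∀ i → suc i < m ∸ 1 → x (suc i) ≈ x i ⁻¹ → x (suc i) ≈ x i) where
      open Index m idx
      open ListFacts.Cutting ε {ℓ}

      m∸1<m : m ∸ 1 < m
      m∸1<m = ∸-monoʳ-< {m} {1} {0} (s≤s z≤n) (≤-trans (s≤s z≤n) 2≤m)

      <m⇒≤m∸1 : ∀ {i} → i < m → i ≤ m ∸ 1
      <m⇒≤m∸1 {i} i<m = ≡.subst (i ≤_) (pred[m∸n]≡m∸[1+n] m 0) (<⇒≤pred i<m)

      cycle : ∀ i → i < m → CycleList (π i)
      cycle i i<m = fromHamCycle (π∈𝒱 i i<m)

      π∈N : ∀ i → i < m → N (π i)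
      π∈N i i<m = N-resp (CycleList.voltage (cycle i i<m)) (CycleList.closed (cycle i i<m))

      commutator : ℕ → Carrier
      commutator i = ⟦ a , x i ⟧

      -- The central factor picked up by splicing in the tail of r cosets after coset i.
      tailVoltage : ℕ → ℕ → Carrier
      tailVoltage zero    i = ε
      tailVoltage (suc r) i = (tailVoltage r (suc i) ∙ π (suc i)) ∙ commutator i

      tailVoltage-N : ∀ r i → i + r < m → N (tailVoltage r i)
      tailVoltage-N zero    i _      = N-ε
      tailVoltage-N (suc r) i i+r<m =
        N-∙ (N-∙ (tailVoltage-N r (suc i) lt) (π∈N (suc i) (≤-<-trans (m≤m+n (suc i) r) lt))) (N-comm a (x i))
        where lt : suc i + r < m
              lt = ≡.subst (_< m) (+-suc i r) i+r<m

      tailVoltage-closed : ∀ r i → i + r < m →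
                           tailVoltage r i ∙ π i ≈ prodFrom π i (suc r) ∙ prodFrom commutator i r
      tailVoltage-closed zero    i _      = trans (identityˡ _) (sym (trans (identityʳ _) (identityʳ _)))
      tailVoltage-closed (suc r) i i+r<m = begin
        ((tailVoltage r (suc i) ∙ π (suc i)) ∙ commutator i) ∙ π i
          ≈⟨ ∙-congʳ (∙-congʳ (tailVoltage-closed r (suc i) lt)) ⟩
        ((prodFrom π (suc i) (suc r) ∙ prodFrom commutator (suc i) r) ∙ commutator i) ∙ π i
          ≈⟨ central-shuffle (prodFrom-N π (suc i) (suc r) π-later∈N)
                             (prodFrom-N commutator (suc i) r (λ j _ → N-comm a (x j)))
                             (N-comm a (x i)) (π∈N i (≤-<-trans (m≤m+n i (suc r)) i+r<m)) ⟩
        (π i ∙ prodFrom π (suc i) (suc r)) ∙ (commutator i ∙ prodFrom commutator (suc i) r) ∎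
        where
          lt : suc i + r < m
          lt = ≡.subst (_< m) (+-suc i r) i+r<m
          π-later∈N : ∀ j → j < suc i + suc r → N (π j)
          π-later∈N j j< = π∈N j (≤-<-trans (≤-pred (≡.subst (j <_) (+-suc (suc i) r) j<)) lt)

      Later : ℕ → Carrier → Set (c ⊔ ℓ)
      Later i₀ u = Σ ℕ λ i' → suc i₀ ≤ i' × i' < m × InCoset i' u

      record TailPath (r i₀ : ℕ) (w : Carrier) : Set (c ⊔ ℓ) where
        field
          steps    : List Carrier
          valid    : All (Step (suc k)) steps
          distinct : Distinct (path w steps)
          within   : All (Later i₀) (path w steps)
          onto     : ∀ {h} i' → suc i₀ ≤ i' → i' < m → InCoset i' h → Visits h (path w steps)
          voltage  : Π steps ≈ tailVoltage r (suc i₀) ∙ (π (suc i₀) ∙ x i₀)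
          keeps-x  : Any (_≈ x i₀) steps
          uses-σ   : ∀ j → j < k → Any (_≈ σ j) steps ⊎ Any (_≈ σ j ⁻¹) steps

      module CutAt {i} (i<m : i < m) {r : ℕ} (K : CutOne (CycleList.steps (cycle i i<m)) r)
                   {w} (w∈ : InCoset i w) where
        C : CycleList (π i)
        C = cycle i i<m
        open CutOne K public

        last : Carrier
        last = at ε (CycleList.steps C) r

        tour : Tour i w (π i) (rest ++ [ last ])
        tour = Tour-≡ YX≡ (Rotate.tour C {X} {Y} t≡XY w∈)

        rest-valid : All (Step k) rest
        rest-valid = AllP.++⁻ˡ rest (Tour.valid tour)

        rest-Gk : All (Gk k) rest
        rest-Gk = All.map Step⇒Gk rest-valid

      lastTail : ∀ i₀ → suc i₀ ≡ m ∸ 1 → ∀ {w} → InCoset (suc i₀) w → TailPath 0 i₀ w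
      lastTail i₀ i≡ {w} w∈ = record
        { steps = rest
        ; valid = All.map Step-suc rest-valid
        ; distinct = ≡.subst Distinct (vertices-∷ʳ w rest last) (Tour.distinct tour)
        ; within = All.map (λ u∈ → i , ≤-refl , i<m , u∈) (path-InCoset rest w∈ rest-Gk)
        ; onto = λ {h} i' i≤i' i'<m h∈ →
            ≡.subst (Visits h) (vertices-∷ʳ w rest last)
              (Tour.onto tour (≡.subst (λ z → InCoset z h)
                 (≤-antisym (≡.subst (i' ≤_) (≡.sym i≡) (<m⇒≤m∸1 i'<m)) i≤i') h∈))
        ; voltage = trans (Π-drop-last rest last (π i) (x i₀) (Tour.voltage tour) last≈) (sym (identityˡ _))
        ; keeps-x = keeps-x
        ; uses-σ = λ j j<k → [ inj₁ ∘ proj₁ , [ inj₂ ∘ proj₂ , inj₁ ∘ proj₂ ]′ ]′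
                               (survivors K (CycleList.covers (cycle i i<m) j j<k))
        }
        where
          i = suc i₀
          i<m : i < m
          i<m = ≡.subst (_< m) (≡.sym i≡) m∸1<m
          i₀<m∸1 : i₀ < m ∸ 1
          i₀<m∸1 = ≡.subst (i₀ <_) i≡ (n<1+n i₀)
          site : TwoSites (_≈ x i₀ ⁻¹) (_≈ x i₀ ⁻¹ ⁻¹) ε (CycleList.steps (cycle i i<m))
          site = sitesOf (cycle i i<m) (x i₀ ⁻¹) (Step-⁻¹ (x-step i₀ i₀<m∸1))
          K : CutOne (CycleList.steps (cycle i i<m)) (TwoSites.p₁ site)
          K = cutOne _ (TwoSites.p₁ site) (TwoSites.p₁< site)
          open CutAt i<m K w∈
          last≈ : last ≈ x i₀ ⁻¹
          last≈ = TwoSites.at₁ site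
          keeps-x : Any (_≈ x i₀) rest
          keeps-x with survivors K (sitesOf C (x i₀) (x-step i₀ i₀<m∸1))
          ... | inj₁ (found , _)          = found
          ... | inj₂ (inj₁ (x≈last , found⁻¹)) =
                Any.map (λ e → trans e (trans (sym last≈) x≈last)) found⁻¹
          ... | inj₂ (inj₂ (_ , found))   = found

      -- In the cycle of a middle coset aⁱG_k (i = i₀+1 < m-1), the steps
      -- x_{i₀}⁻¹ and x_i can be found at different positions: if they only
      -- occur at the same position then x_i = x_{i₀}⁻¹, hence x_i = x_{i₀}
      -- by coherence, and x_{i₀}⁻¹ also occurs where x_{i₀}⁻¹⁻¹ does.
      exitSites : ∀ i₀ (i<m∸1 : suc i₀ < m ∸ 1) →
                  TwoSites (_≈ x i₀ ⁻¹) (_≈ x (suc i₀)) ε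
                           (CycleList.steps (cycle (suc i₀) (<-trans i<m∸1 m∸1<m)))
      exitSites i₀ i<m∸1 = pick (sitesOf C (x i₀ ⁻¹) (Step-⁻¹ (x-step i₀ (<-trans (n<1+n i₀) i<m∸1))))
                                (sitesOf C (x (suc i₀)) (x-step (suc i₀) i<m∸1))
        where
          C : CycleList (π (suc i₀))
          C = cycle (suc i₀) (<-trans i<m∸1 m∸1<m)
          t : List Carrier
          t = CycleList.steps C
          pick : TwoSites (_≈ x i₀ ⁻¹) (_≈ x i₀ ⁻¹ ⁻¹) ε t → TwoSites (_≈ x (suc i₀)) (_≈ x (suc i₀) ⁻¹) ε t →
                 TwoSites (_≈ x i₀ ⁻¹) (_≈ x (suc i₀)) ε t
          pick (sites p₁ q₁ p₁< q₁< p₁≢q₁ e₁ e₁') (sites p₂ _ p₂< _ _ e₂ _) with p₁ ≟ p₂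
          ... | no p₁≢p₂ = sites p₁ p₂ p₁< p₂< p₁≢p₂ e₁ e₂
          ... | yes ≡.refl = sites q₁ p₁ q₁< p₁< (λ e → p₁≢q₁ (≡.sym e)) e₁'' e₂
            where
              collide : x (suc i₀) ≈ x i₀ ⁻¹
              collide = trans (sym e₂) e₁
              e₁'' : at ε t q₁ ≈ x i₀ ⁻¹
              e₁'' = trans e₁' (trans (⁻¹-involutive _) (trans (sym (x-coherent i₀ i<m∸1 collide)) collide))

      record MiddleCut (i₀ : ℕ) (w : Carrier) : Set (c ⊔ ℓ) where
        field
          left right : List Carrier
          e₁ e₂      : Carrier
          e₁≈        : e₁ ≈ x i₀ ⁻¹
          e₂≈        : e₂ ≈ x (suc i₀)
          tour       : Tour (suc i₀) w (π (suc i₀)) (left ++ e₂ ∷ right ++ [ e₁ ])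
          keeps-x    : (Any (_≈ x i₀) left ⊎ Any (_≈ x i₀) right) ⊎ x (suc i₀) ≈ x i₀

        valid : All (Step k) (left ++ e₂ ∷ right ++ [ e₁ ])
        valid = Tour.valid tour

        left-valid : All (Step k) left
        left-valid = AllP.++⁻ˡ left valid

        right-valid : All (Step k) right
        right-valid = AllP.++⁻ˡ right (All.tail (AllP.++⁻ʳ left valid))

      middleCut : ∀ i₀ → suc i₀ < m ∸ 1 → ∀ {w} → InCoset (suc i₀) w → MiddleCut i₀ w
      middleCut i₀ i<m∸1 {w} w∈ =
        fromCut (cutTwo t r₁ r₂ (TwoSites.p₁< exits) (TwoSites.p₂< exits) (TwoSites.p₁≢p₂ exits))
                (sitesOf C (x i₀) (x-step i₀ (<-trans (n<1+n i₀) i<m∸1)))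
        where
          C : CycleList (π (suc i₀))
          C = cycle (suc i₀) (<-trans i<m∸1 m∸1<m)
          t : List Carrier
          t = CycleList.steps C
          exits : TwoSites (_≈ x i₀ ⁻¹) (_≈ x (suc i₀)) ε t
          exits = exitSites i₀ i<m∸1
          r₁ r₂ : ℕ
          r₁ = TwoSites.p₁ exits
          r₂ = TwoSites.p₂ exits
          e₁≈ : at ε t r₁ ≈ x i₀ ⁻¹
          e₁≈ = TwoSites.at₁ exits
          e₂≈ : at ε t r₂ ≈ x (suc i₀)
          e₂≈ = TwoSites.at₂ exits
          fromCut : CutTwo t r₁ r₂ → TwoSites (_≈ x i₀) (_≈ x i₀ ⁻¹) ε t → MiddleCut i₀ w
          fromCut K (sites p q p< q< p≢q ep eq) = record
            { left = left ; right = right ; e₁ = at ε t r₁ ; e₂ = at ε t r₂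
            ; e₁≈ = e₁≈ ; e₂≈ = e₂≈
            ; tour = Tour-≡ YX≡ (Rotate.tour C {X} {Y} t≡XY w∈)
            ; keeps-x = [ at-r₁ , [ at-r₂ ep , [ inj₁ ∘ inj₁ , inj₁ ∘ inj₂ ]′ ]′ ]′ (locate K _ p p< ep)
            }
            where
              open CutTwo K
              at-r₂ : ∀ {s y} → at ε t s ≈ y → s ≡ r₂ → (Any (_≈ x i₀) left ⊎ Any (_≈ x i₀) right) ⊎ x (suc i₀) ≈ y
              at-r₂ e s≡r₂ = inj₂ (trans (sym e₂≈) (trans (reflexive (≡.cong (at ε t) (≡.sym s≡r₂))) e))
              -- if x_{i₀} sits where x_{i₀}⁻¹ was cut, then x_{i₀}⁻¹ = x_{i₀}, and its other site survives
              at-r₁ : p ≡ r₁ → (Any (_≈ x i₀) left ⊎ Any (_≈ x i₀) right) ⊎ x (suc i₀) ≈ x i₀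
              at-r₁ p≡r₁ =
                [ (λ q≡r₁ → ⊥-elim (p≢q (≡.trans p≡r₁ (≡.sym q≡r₁))))
                , [ at-r₂ (trans eq self-inverse)
                  , [ (λ l → inj₁ (inj₁ (Any.map (λ e → trans e self-inverse) l)))
                    , (λ r → inj₁ (inj₂ (Any.map (λ e → trans e self-inverse) r))) ]′ ]′ ]′
                  (locate K _ q q< eq)
                where self-inverse : x i₀ ⁻¹ ≈ x i₀
                      self-inverse = trans (sym e₁≈) (trans (reflexive (≡.cong (at ε t) (≡.sym p≡r₁))) ep)

      a-step : Step (suc k) a
      a-step = k , n<1+n k , inj₁ refl

      a⁻¹-step : Step (suc k) (a ⁻¹)
      a⁻¹-step = k , n<1+n k , inj₂ refl

      module Splice (r i₀ : ℕ) (bound : suc i₀ + suc r ≡ m ∸ 1) {w : Carrier} (w∈ : InCoset (suc i₀) w)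
                    (M : MiddleCut i₀ w) (tail : TailPath r (suc i₀) (end w (MiddleCut.left M) ∙ a)) where
        open MiddleCut M
        private module T = TailPath tail

        i : ℕ
        i = suc i₀

        i<m : i < m
        i<m = <-trans (≡.subst (i <_) (≡.trans (≡.sym (+-suc i r)) bound) (s≤s (m≤m+n i r))) m∸1<m

        W₀ w' back : Carrier
        W₀ = end w left
        w' = W₀ ∙ a
        back = end w' T.steps ∙ a ⁻¹

        steps : List Carrier
        steps = left ++ a ∷ T.steps ++ a ⁻¹ ∷ right

        before during after : List Carrier
        before = path w left
        during = path w' T.steps
        after = path back right

        path-split : path w steps ≡ before ++ during ++ after
        path-split =
          ≡.trans (path-++ w left (a ∷ T.steps ++ a ⁻¹ ∷ right))
          (≡.trans (≡.cong (λ z → vertices w left ++ W₀ ∷ z)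
                     (≡.trans (path-++ w' T.steps (a ⁻¹ ∷ right))
                              (≡.sym (++-assoc (vertices w' T.steps) [ end w' T.steps ] after))))
                   (≡.sym (++-assoc (vertices w left) [ W₀ ] (during ++ after))))

        Z : Carrier
        Z = tailVoltage r (suc i) ∙ π (suc i)

        Z∈N : N Z
        Z∈N = N-∙ (tailVoltage-N r (suc i) lt) (π∈N (suc i) (≤-<-trans (m≤m+n (suc i) r) lt))
          where lt : suc i + r < m
                lt = ≡.subst (_< m) (≡.sym (≡.trans (≡.sym (+-suc i r)) bound)) m∸1<m

        tail-voltage : Π T.steps ≈ Z ∙ x i
        tail-voltage = trans T.voltage (sym (assoc _ _ _))

        -- the detour returns to the class that the replaced step x_i led to
        returns : back ~ (W₀ ∙ e₂)
        returns = ~-trans (≈⇒~ back≈) (~-trans (∙-~ˡ W₀ (N-absorb (x i) (N-∙ Z∈N (N-comm a (x i)))))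
                                               (≈⇒~ (∙-congˡ (sym e₂≈))))
          where back≈ : back ≈ W₀ ∙ ((Z ∙ ⟦ a , x i ⟧) ∙ x i)
                back≈ = begin
                  end w' T.steps ∙ a ⁻¹                ≈⟨ ∙-congʳ (end≈ w' T.steps) ⟩
                  (w' ∙ Π T.steps) ∙ a ⁻¹              ≈⟨ ∙-congʳ (∙-congˡ tail-voltage) ⟩
                  ((W₀ ∙ a) ∙ (Z ∙ x i)) ∙ a ⁻¹        ≈⟨ solve monoid ⟩
                  W₀ ∙ ((a ∙ (Z ∙ x i)) ∙ a ⁻¹)        ≈⟨ ∙-congˡ (conj-central a Z (x i) Z∈N) ⟩
                  W₀ ∙ ((Z ∙ ⟦ a , x i ⟧) ∙ x i)       ∎

        bypass : (before ++ after) ~ᴸ vertices w (left ++ e₂ ∷ right ++ [ e₁ ])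
        bypass = ~ᴸ-trans (≡⇒~ᴸ (++-assoc (vertices w left) [ W₀ ] after))
                 (~ᴸ-trans (PW.++⁺ ~ᴸ-refl (~-refl ∷ path-~ right returns))
                           (≡⇒~ᴸ (≡.sym (≡.trans (vertices-++ w left (e₂ ∷ right ++ [ e₁ ]))
                                        (≡.cong (λ z → vertices w left ++ W₀ ∷ z) (vertices-∷ʳ (W₀ ∙ e₂) right e₁))))))

        before-after-in-coset : All (InCoset i) (before ++ after)
        before-after-in-coset =
          PW.All-resp-Pointwise (λ u~v u∈ → InCoset-~ u∈ u~v) (~ᴸ-sym bypass)
            (vertices-InCoset (left ++ e₂ ∷ right ++ [ e₁ ]) w∈ (All.map Step⇒Gk valid))

        in-tail : ∀ {Q : Carrier → Set ℓ} → Any Q T.steps → Any Q steps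
        in-tail q = ++⁺ʳ left (there (++⁺ˡ q))

        in-right : ∀ {Q : Carrier → Set ℓ} → Any Q right → Any Q steps
        in-right q = ++⁺ʳ left (there (++⁺ʳ T.steps (there q)))

        distinct : Distinct (path w steps)
        distinct = ≡.subst Distinct (≡.sym path-split)
          (AllPairs-insert before (Distinct-~ᴸ (Tour.distinct tour) (~ᴸ-sym bypass)) T.distinct
            (All.map (λ u∈ → All.map (λ { (i' , i<i' , i'<m , v∈) → coset-disjoint u∈ v∈ i<i' i'<m }) T.within)
                     before-after-in-coset))

        within : All (Later i₀) (path w steps)
        within = ≡.subst (All (Later i₀)) (≡.sym path-split)
          (AllP.++⁺ (AllP.++⁻ˡ before here-i)
            (AllP.++⁺ (All.map (λ { (i' , i<i' , i'<m , v∈) → i' , <⇒≤ i<i' , i'<m , v∈ }) T.within)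
                      (AllP.++⁻ʳ before here-i)))
          where here-i : All (Later i₀) (before ++ after)
                here-i = All.map (λ u∈ → i , ≤-refl , i<m , u∈) before-after-in-coset

        onto : ∀ {h} i' → i ≤ i' → i' < m → InCoset i' h → Visits h (path w steps)
        onto {h} i' i≤i' i'<m h∈ = ≡.subst (Visits h) (≡.sym path-split) (visit (i ≟ i'))
          where
            visit : Dec (i ≡ i') → Visits h (before ++ during ++ after)
            visit (yes ≡.refl) = Any-insert before during
                                   (Visits-~ᴸ (Tour.onto tour h∈) (~ᴸ-sym bypass))
            visit (no i≢i')    = ++⁺ʳ before (++⁺ˡ (T.onto i' (≤∧≢⇒< i≤i' i≢i') i'<m h∈))

        voltage : Π steps ≈ tailVoltage (suc r) i ∙ (π i ∙ x i₀)
        voltage = begin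
          Π steps                                           ≈⟨ trans (Π-++ left _) (∙-congˡ (∙-congˡ (Π-++ T.steps _))) ⟩
          Π left ∙ (a ∙ (Π T.steps ∙ (a ⁻¹ ∙ Π right)))     ≈⟨ ∙-congˡ (∙-congˡ (∙-congʳ tail-voltage)) ⟩
          Π left ∙ (a ∙ ((Z ∙ x i) ∙ (a ⁻¹ ∙ Π right)))     ≈⟨ detour-voltage a (Π left) (Π right) Z (x i) Z∈N ⟩
          (Z ∙ ⟦ a , x i ⟧) ∙ (Π left ∙ (x i ∙ Π right))    ≈⟨ ∙-congˡ bypass-voltage ⟩
          (Z ∙ ⟦ a , x i ⟧) ∙ (π i ∙ x i₀)                  ∎
          where
            bypass-voltage : Π left ∙ (x i ∙ Π right) ≈ π i ∙ x i₀
            bypass-voltage = begin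
              Π left ∙ (x i ∙ Π right)     ≈⟨ ∙-congˡ (∙-congʳ e₂≈) ⟨
              Π left ∙ (e₂ ∙ Π right)      ≈⟨ Π-++ left (e₂ ∷ right) ⟨
              Π (left ++ e₂ ∷ right)       ≈⟨ Π-drop-last (left ++ e₂ ∷ right) e₁ (π i) (x i₀)
                                               (trans (reflexive (≡.cong Π (++-assoc left (e₂ ∷ right) [ e₁ ])))
                                                      (Tour.voltage tour)) e₁≈ ⟩
              π i ∙ x i₀                   ∎

        result : TailPath (suc r) i₀ w
        result = record
          { steps = steps
          ; valid = AllP.++⁺ (All.map Step-suc left-valid)
                      (a-step ∷ AllP.++⁺ T.valid (a⁻¹-step ∷ All.map Step-suc right-valid))
          ; distinct = distinct
          ; within = within
          ; onto = onto
          ; voltage = voltage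
          ; keeps-x = [ [ ++⁺ˡ , in-right ]′ , (λ xi≈ → in-tail (Any.map (λ e → trans e xi≈) T.keeps-x)) ]′ keeps-x
          ; uses-σ = λ j j<k → Sum.map in-tail in-tail (T.uses-σ j j<k)
          }

      tailPath : ∀ r i₀ → suc i₀ + r ≡ m ∸ 1 → ∀ {w} → InCoset (suc i₀) w → TailPath r i₀ w
      tailPath zero    i₀ bound w∈ = lastTail i₀ (≡.trans (≡.sym (+-identityʳ (suc i₀))) bound) w∈
      tailPath (suc r) i₀ bound {w} w∈ =
        Splice.result r i₀ bound w∈ M
          (tailPath r (suc i₀) (≡.trans (≡.sym (+-suc (suc i₀) r)) bound)
                    (InCoset-a (end-InCoset (MiddleCut.left M) w∈ (All.map Step⇒Gk (MiddleCut.left-valid M)))))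
        where M : MiddleCut i₀ w
              M = middleCut i₀ (≡.subst (suc i₀ <_) bound (m<m+n (suc i₀) (s≤s z≤n))) w∈

      bound₀ : suc 0 + (m ∸ 2) ≡ m ∸ 1
      bound₀ = ≡.cong (_∸ 1) (m+[n∸m]≡n 2≤m)

      total-voltage : ((tailVoltage (m ∸ 2) 1 ∙ π 1) ∙ commutator 0) ∙ π 0 ≈ prod m π ∙ prod (m ∸ 1) commutator
      total-voltage = ≡.subst (λ z → ((tailVoltage (m ∸ 2) 1 ∙ π 1) ∙ commutator 0) ∙ π 0 ≈ prod z π ∙ prod (z ∸ 1) commutator)
                              (m+[n∸m]≡n 2≤m)
                              (closed-form (m ∸ 2) (≤-reflexive (m+[n∸m]≡n 2≤m)))
        where
          closed-form : ∀ n → 2 + n ≤ m →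
                        ((tailVoltage n 1 ∙ π 1) ∙ commutator 0) ∙ π 0 ≈ prod (2 + n) π ∙ prod (1 + n) commutator
          closed-form n 2+n≤m = begin
            ((tailVoltage n 1 ∙ π 1) ∙ commutator 0) ∙ π 0
              ≈⟨ ∙-congʳ (∙-congʳ (tailVoltage-closed n 1 2+n≤m)) ⟩
            ((prodFrom π 1 (suc n) ∙ prodFrom commutator 1 n) ∙ commutator 0) ∙ π 0
              ≈⟨ central-shuffle (prodFrom-N π 1 (suc n) (λ j j< → π∈N j (<-≤-trans j< 2+n≤m)))
                                 (prodFrom-N commutator 1 n (λ j _ → N-comm a (x j))) (N-comm a (x 0))
                                 (π∈N 0 (<-≤-trans (s≤s z≤n) 2+n≤m)) ⟩
            prodFrom π 0 (2 + n) ∙ prodFrom commutator 0 (1 + n)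
              ≈⟨ ∙-cong (prod≈prodFrom π (2 + n)) (prod≈prodFrom commutator (1 + n)) ⟨
            prod (2 + n) π ∙ prod (1 + n) commutator ∎

      first<m∸1 : 0 < m ∸ 1
      first<m∸1 = ≡.subst (0 <_) bound₀ (s≤s z≤n)

      first<m : 0 < m
      first<m = <-trans first<m∸1 m∸1<m

      ε∈ : InCoset 0 ε
      ε∈ = InCoset₀ gen-ε

      firstSite : TwoSites (_≈ x 0) (_≈ x 0 ⁻¹) ε (CycleList.steps (cycle 0 first<m))
      firstSite = sitesOf (cycle 0 first<m) (x 0) (x-step 0 first<m∸1)

      module Top (K : CutOne (CycleList.steps (cycle 0 first<m)) (TwoSites.p₁ firstSite))
                 (tail : TailPath (m ∸ 2) 0 (end ε (CutOne.rest K) ∙ a)) where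
        open CutAt first<m K ε∈
        private module T = TailPath tail

        W₀ w' : Carrier
        W₀ = end ε rest
        w' = W₀ ∙ a

        steps : List Carrier
        steps = rest ++ a ∷ T.steps ++ [ a ⁻¹ ]

        before during : List Carrier
        before = path ε rest
        during = path w' T.steps

        vertices-split : vertices ε steps ≡ before ++ during
        vertices-split =
          ≡.trans (vertices-++ ε rest (a ∷ T.steps ++ [ a ⁻¹ ]))
          (≡.trans (≡.cong (λ z → vertices ε rest ++ W₀ ∷ z) (vertices-∷ʳ w' T.steps (a ⁻¹)))
                   (≡.sym (++-assoc (vertices ε rest) [ W₀ ] during)))

        distinct : Distinct (vertices ε steps)
        distinct = ≡.subst Distinct (≡.sym vertices-split)
          (AllPairsP.++⁺ (≡.subst Distinct (vertices-∷ʳ ε rest last) (Tour.distinct tour)) T.distinct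
            (All.map (λ u∈ → All.map (λ { (i' , 0<i' , i'<m , v∈) → coset-disjoint u∈ v∈ 0<i' i'<m }) T.within)
                     (path-InCoset rest ε∈ rest-Gk)))

        onto : ∀ {h} → Gk (suc k) h → Visits h (vertices ε steps)
        onto {h} h∈ = ≡.subst (Visits h) (≡.sym vertices-split) (visit (coset-cover h∈))
          where
            visit : (Σ ℕ λ e → e < m × InCoset e h) → Visits h (before ++ during)
            visit (zero  , _   , h∈₀) = ++⁺ˡ (≡.subst (Visits h) (vertices-∷ʳ ε rest last) (Tour.onto tour h∈₀))
            visit (suc e , e<m , h∈ₑ) = ++⁺ʳ before (T.onto (suc e) (s≤s z≤n) e<m h∈ₑ)

        voltage : Π steps ≈ prod m π ∙ prod (m ∸ 1) commutator
        voltage = begin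
          Π steps                                         ≈⟨ trans (Π-++ rest _) (∙-congˡ (∙-congˡ (Π-++ T.steps _))) ⟩
          Π rest ∙ (a ∙ (Π T.steps ∙ (a ⁻¹ ∙ ε)))         ≈⟨ ∙-congˡ (∙-congˡ (∙-congʳ (trans T.voltage (sym (assoc _ _ _))))) ⟩
          Π rest ∙ (a ∙ ((Z ∙ x 0) ∙ (a ⁻¹ ∙ ε)))         ≈⟨ detour-voltage a (Π rest) ε Z (x 0) Z∈N ⟩
          (Z ∙ ⟦ a , x 0 ⟧) ∙ (Π rest ∙ (x 0 ∙ ε))        ≈⟨ ∙-congˡ cycle₀ ⟩
          (Z ∙ ⟦ a , x 0 ⟧) ∙ π 0                         ≈⟨ total-voltage ⟩
          prod m π ∙ prod (m ∸ 1) commutator              ∎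
          where
            Z : Carrier
            Z = tailVoltage (m ∸ 2) 1 ∙ π 1
            Z∈N : N Z
            Z∈N = N-∙ (tailVoltage-N (m ∸ 2) 1 lt) (π∈N 1 (≤-<-trans (s≤s z≤n) lt))
              where lt : 1 + (m ∸ 2) < m
                    lt = ≡.subst (_< m) (≡.sym bound₀) m∸1<m
            cycle₀ : Π rest ∙ (x 0 ∙ ε) ≈ π 0
            cycle₀ = trans (∙-congˡ (∙-congʳ (sym (TwoSites.at₁ firstSite))))
                           (trans (sym (Π-++ rest [ last ])) (Tour.voltage tour))

        closed : N (Π steps)
        closed = N-resp (sym voltage) (N-∙ (prod-N π m π∈N) (prod-N commutator (m ∸ 1) (λ j _ → N-comm a (x j))))
          where prod-N : ∀ f n → (∀ j → j < n → N (f j)) → N (prod n f)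
                prod-N f n f∈N = N-resp (sym (prod≈prodFrom f n)) (prodFrom-N f 0 n f∈N)

        rest-tail : ∀ {Q₁ Q₂ : Carrier → Set ℓ} → Any Q₁ rest → Any Q₂ T.steps → TwoSites Q₁ Q₂ ε steps
        rest-tail q₁ q₂ = ListFacts.sites-++ ε rest (a ∷ T.steps ++ [ a ⁻¹ ]) q₁ (there (++⁺ˡ q₂))

        covers-a : TwoSites (_≈ σ k) (_≈ σ k ⁻¹) ε steps
        covers-a = ≡.subst (TwoSites _ _ ε) (++-assoc rest [ a ] (T.steps ++ [ a ⁻¹ ]))
                     (ListFacts.sites-++ ε (rest ++ [ a ]) (T.steps ++ [ a ⁻¹ ])
                        (++⁺ʳ rest (here refl)) (++⁺ʳ T.steps (here refl)))

        -- for j < k: of the two sites in the cycle of G_k at most one was cut,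
        -- and if one was, it carried x_0, which the tail contains
        covers-below : ∀ j → j < k →
          (Any (_≈ σ j) rest × Any (_≈ σ j ⁻¹) rest) ⊎ (last ≈ σ j × Any (_≈ σ j ⁻¹) rest) ⊎
            (last ≈ σ j ⁻¹ × Any (_≈ σ j) rest) → TwoSites (_≈ σ j) (_≈ σ j ⁻¹) ε steps
        covers-below j j<k (inj₁ (σ∈rest , σ⁻¹∈rest)) =
          [ (λ σ∈T → swapSites (rest-tail σ⁻¹∈rest σ∈T)) , rest-tail σ∈rest ]′ (T.uses-σ j j<k)
        covers-below j j<k (inj₂ (inj₁ (last≈σ , σ⁻¹∈rest))) =
          swapSites (rest-tail σ⁻¹∈rest (Any.map (λ e → trans e (trans (sym (TwoSites.at₁ firstSite)) last≈σ)) T.keeps-x))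
        covers-below j j<k (inj₂ (inj₂ (last≈σ⁻¹ , σ∈rest))) =
          rest-tail σ∈rest (Any.map (λ e → trans e (trans (sym (TwoSites.at₁ firstSite)) last≈σ⁻¹)) T.keeps-x)

        covers : ∀ j → j < suc k → TwoSites (_≈ σ j) (_≈ σ j ⁻¹) ε steps
        covers j j<1+k = [ (λ j<k → covers-below j j<k (survivors K (CycleList.covers C j j<k)))
                         , (λ j≡k → ≡.subst (λ z → TwoSites (_≈ σ z) (_≈ σ z ⁻¹) ε steps) (≡.sym j≡k) covers-a) ]′
                         (m<1+n⇒m<n∨m≡n j<1+k)

        hamiltonian : Σ (HamCycle (suc k)) λ C → HamCycle.Covers C × HamCycle.voltage C ≈ prod m π ∙ prod (m ∸ 1) commutator
        hamiltonian = toHamCycle steps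
          (AllP.++⁺ (All.map Step-suc rest-valid) (a-step ∷ AllP.++⁺ T.valid (a⁻¹-step ∷ [])))
          distinct onto closed covers voltage

      hamiltonian : Σ (HamCycle (suc k)) λ C → HamCycle.Covers C × HamCycle.voltage C ≈ prod m π ∙ prod (m ∸ 1) commutator
      hamiltonian = Top.hamiltonian K (tailPath (m ∸ 2) 0 bound₀ (InCoset-a (end-InCoset (CutOne.rest K) ε∈ rest-Gk)))
        where
          K : CutOne (CycleList.steps (cycle 0 first<m)) (TwoSites.p₁ firstSite)
          K = cutOne _ (TwoSites.p₁ firstSite) (TwoSites.p₁< firstSite)
          rest-Gk : All (Gk k) (CutOne.rest K)
          rest-Gk = CutAt.rest-Gk first<m K ε∈

  module Minimality (L : ℕ) (distinct-mod-N : DistinctModN L) (minimal : MinimalGeneratingModN L) where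

    allBut : ℕ → ℕ → Bool
    allBut j i with i ≟ j
    ... | yes _ = false
    ... | no _  = true

    allBut-self : ∀ j → allBut j j ≡ false
    allBut-self j with j ≟ j
    ... | yes _   = ≡.refl
    ... | no j≢j  = ⊥-elim (j≢j ≡.refl)

    allBut-other : ∀ j i → i ≢ j → allBut j i ≡ true
    allBut-other j i i≢j with i ≟ j
    ... | yes i≡j = ⊥-elim (i≢j i≡j)
    ... | no _    = ≡.refl

    Others : ℕ → Subset
    Others j x = Level.Lift (c ⊔ ℓ) (Σ ℕ λ i → i < L × allBut j i ≡ true × x ≈ σ i)

    σ-essential : ∀ j → j < L → ¬ Gen (Others j ∪ N) (σ j)
    σ-essential j j<L σj∈ = proj₂ minimal (allBut j) (j , j<L , allBut-self j) (λ g → Gen-map others (proj₁ minimal g))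
      where others : ∀ {x} → ((λ x → Level.Lift (c ⊔ ℓ) (Σ ℕ λ i → i < L × true ≡ true × x ≈ σ i)) ∪ N) x →
                     Gen (Others j ∪ N) x
            others (inj₂ x∈N) = gen (inj₂ x∈N)
            others (inj₁ (Level.lift (i , i<L , _ , x≈σi))) with i ≟ j
            ... | yes ≡.refl = gen-≈ (sym x≈σi) σj∈
            ... | no i≢j     = gen (inj₁ (Level.lift (i , i<L , allBut-other j i i≢j , x≈σi)))

    -- σ_k ∉ G_k, since G_k is generated by N and σ_0, …, σ_{k-1}
    σ∉Gk : ∀ k → k < L → ¬ Gk k (σ k)
    σ∉Gk k k<L σk∈ = σ-essential k k<L (Gen-map earlier σk∈)
      where earlier : ∀ {x} → (S k ∪ N) x → Gen (Others k ∪ N) x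
            earlier (inj₁ (Level.lift (i , i<k , x≈σi))) =
              gen (inj₁ (Level.lift (i , <-trans i<k k<L , allBut-other k i (<⇒≢ i<k) , x≈σi)))
            earlier (inj₂ x∈N) = gen (inj₂ x∈N)

    index≥2 : ∀ k → k < L → ∀ m → IsIndex (Gk (suc k)) (Gk k) m → 2 ≤ m
    index≥2 k k<L zero idx with _ , () , _ ← proj₁ (proj₂ (proj₂ idx)) {ε} gen-ε
    index≥2 k k<L (suc zero) idx with Cosets.Index.power-in-Gk k 1 idx
    ... | suc zero , _ , _ , a∈Gk = ⊥-elim (σ∉Gk k k<L (gen-≈ (identityˡ (σ k)) a∈Gk))
    ... | suc (suc _) , _ , s≤s () , _
    index≥2 k k<L (suc (suc m)) idx = s≤s (s≤s z≤n)

    σ-collision : ∀ {j₁ j₀} → j₁ < L → j₀ < L → σ j₁ ≈ σ j₀ ⊎ σ j₁ ≈ σ j₀ ⁻¹ → j₁ ≡ j₀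
    σ-collision {j₁} {j₀} j₁<L j₀<L (inj₁ same) = distinct-mod-N j₁ j₀ j₁<L j₀<L (≈⇒~ same)
    σ-collision {j₁} {j₀} j₁<L j₀<L (inj₂ inverse) with j₁ ≟ j₀
    ... | yes j₁≡j₀ = j₁≡j₀
    ... | no j₁≢j₀  = ⊥-elim (σ-essential j₁ j₁<L (gen-≈ (sym inverse)
                        (gen-⁻¹ (gen (inj₁ (Level.lift (j₀ , j₀<L , allBut-other j₁ j₀ (j₁≢j₀ ∘ ≡.sym) , refl)))))))

    inverse-signs : ∀ {u v j₁ j₀} → (u ≈ σ j₁ ⊎ u ≈ σ j₁ ⁻¹) → (v ≈ σ j₀ ⊎ v ≈ σ j₀ ⁻¹) → u ≈ v ⁻¹ →
                    σ j₁ ≈ σ j₀ ⊎ σ j₁ ≈ σ j₀ ⁻¹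
    inverse-signs (inj₁ u≈) (inj₁ v≈) u≈v⁻¹ = inj₂ (trans (sym u≈) (trans u≈v⁻¹ (⁻¹-cong v≈)))
    inverse-signs (inj₁ u≈) (inj₂ v≈) u≈v⁻¹ = inj₁ (trans (sym u≈) (trans u≈v⁻¹ (trans (⁻¹-cong v≈) (⁻¹-involutive _))))
    inverse-signs (inj₂ u≈) (inj₁ v≈) u≈v⁻¹ = inj₁ (⁻¹-injective (trans (sym u≈) (trans u≈v⁻¹ (⁻¹-cong v≈))))
    inverse-signs (inj₂ u≈) (inj₂ v≈) u≈v⁻¹ =
      inj₂ (trans (sym (⁻¹-involutive _)) (⁻¹-cong (trans (sym u≈) (trans u≈v⁻¹ (trans (⁻¹-cong v≈) (⁻¹-involutive _))))))

    signs : ∀ {u v j} → v ≈ σ j → u ≈ v ⊎ u ≈ v ⁻¹ → u ≈ σ j ⊎ u ≈ σ j ⁻¹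
    signs v≈σj = Sum.map (λ e → trans e v≈σj) (λ e → trans e (⁻¹-cong v≈σj))

    signed-step : ∀ {k u v} → S k v → u ≈ v ⊎ u ≈ v ⁻¹ → Step k u
    signed-step (Level.lift (j , j<k , v≈σj)) sign = j , j<k , signs v≈σj sign

    signs-coherent : ∀ {k u₁ u₀ v₁ v₀} → k ≤ L → S k v₁ → S k v₀ →
                     u₁ ≈ v₁ ⊎ u₁ ≈ v₁ ⁻¹ → u₀ ≈ v₀ ⊎ u₀ ≈ v₀ ⁻¹ → u₁ ≈ u₀ ⁻¹ → v₁ ≈ v₀
    signs-coherent k≤L (Level.lift (j₁ , j₁<k , v₁≈σj₁)) (Level.lift (j₀ , j₀<k , v₀≈σj₀)) sign₁ sign₀ inverse =
      trans v₁≈σj₁ (trans (reflexive (≡.cong σ same)) (sym v₀≈σj₀))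
      where
        same : j₁ ≡ j₀
        same = σ-collision (<-≤-trans j₁<k k≤L) (<-≤-trans j₀<k k≤L)
                 (inverse-signs (signs v₁≈σj₁ sign₁) (signs v₀≈σj₀ sign₀) inverse)

corollary5p3 : ∀ {c ℓ : Level} (G : Group c ℓ) →
    let open Group G
        open GroupDefs G
    in IsFinite → IsNilpotent →
       (N : Subset) → IsNormalSubgroup N → IsCyclic N → DerivedSubgroup ⊆ N →
       (L : ℕ) (σ : ℕ → Carrier) →
       let open WithN N σ
       in DistinctModN L → MinimalGeneratingModN L → 2 ≤ L →
          (k : ℕ) → 2 ≤ k → k < L →
          (m : ℕ) → IsIndex (Gk (suc k)) (Gk k) m →
          (π : ℕ → Carrier) → (∀ i → i < m → 𝒱 k (π i)) →
          (s s* : ℕ → Carrier) →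
          (∀ i → i < m ∸ 1 → S k (s i)) →
          (∀ i → i < m ∸ 1 → s* i ≈ s i ⊎ s* i ≈ s i ⁻¹) →
          (∀ i → suc i < m ∸ 1 → s (suc i) ≈ s i → s* (suc i) ≈ s* i) →
          Central N →
          Σ (HamCycle (suc k)) λ C →
            HamCycle.Covers C ×
            HamCycle.voltage C ≈ prod m π ∙ prod (m ∸ 1) (λ i → ⟦ σ k , s* i ⟧)
corollary5p3 G _ _ N N-normal _ G'⊆N L σ distinct-mod-N minimal _ k _ k<L m idx π π∈𝒱 s s* s∈S s*-sign
             s*-respects N-central =
  Construction.hamiltonian m idx (index≥2 k k<L m idx) π π∈𝒱 s*
    (λ i i<m∸1 → signed-step (s∈S i i<m∸1) (s*-sign i i<m∸1))
    (λ i i+1<m∸1 inverse → s*-respects i i+1<m∸1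
       (signs-coherent (<⇒≤ k<L) (s∈S (suc i) i+1<m∸1) (s∈S i (previous i+1<m∸1))
                       (s*-sign (suc i) i+1<m∸1) (s*-sign i (previous i+1<m∸1)) inverse))
  where
    open Setting G N N-normal G'⊆N N-central σ
    open Minimality L distinct-mod-N minimal
    open Cosets k

    previous : ∀ {i} → suc i < m ∸ 1 → i < m ∸ 1
    previous {i} = <-trans (n<1+n i)
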